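{- Let $n \ge k \ge 2$ be integers with $k \equiv 2$ or $3 \pmod 4$. The following are equivalent: (i) $P_{n,k}(1/2) = 0$; (ii) $P_{n,k}$ is the zero polynomial; (iii) $n \ge R(k)$.
   Context: $[n]=\{1,\dots,n\}$; $\binom{S}{j}$ is the set of $j$-element subsets of $S$. Let $\mathcal{A}$ be the set of assignments $\mathfrak{g}$ which associate to each $S \in \binom{[n]}{k}$ a finite simple undirected graph $\mathfrak{g}_S$ on vertex set $S$ which is neither the complete graph nor the empty graph on $S$. For $\mathfrak{g}\in\mathcal{A}$, let $\mathrm{Edges}(\mathfrak{g}) := \bigcup_{S} \mathbf{E}(\mathfrak{g}_S) \subseteq \binom{[n]}{2}$ and $\mathrm{sign}(\mathfrak{g}) := \prod_{S} (-1)^{|\mathbf{E}(\mathfrak{g}_S)|}$. Define $P_{n,k}(t) := \sum_{\mathfrak{g}\in\mathcal{A}} \mathrm{sign}(\mathfrak{g})\, t^{|\mathrm{Edges}(\mathfrak{g})|} \in \mathbb{Z}[t]$. The $k$-th diagonal Ramsey number $R(k)$ is the least positive integer $n$ such that every graph on $n$ vertices contains a clique of size $k$ or an independent set of size $k$. -}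

module Defs where

open import Data.Bool using (Bool; true; false; if_then_else_; _∧_; _∨_; not)
open import Data.Nat as ℕ using (ℕ; zero; suc; _≡ᵇ_; _<ᵇ_)
open import Data.Fin as Fin using (Fin)
open import Data.Fin.Subset using (Subset; _∈_)
open import Data.Fin.Subset.Properties using ()
open import Data.List using (List; []; _∷_; [_]; map; _++_; concatMap; length; foldr; allFin; sum)
open import Data.Product using (_×_; _,_; proj₁; proj₂)
open import Data.Integer as ℤ using (ℤ)
open import Data.Rational as ℚ using (ℚ)
open import Relation.Binary.PropositionalEquality using (_≡_; _≢_)
open import Relation.Nullary.Decidable using (⌊_⌋)

choose : {A : Set} → ℕ → List A → List (List A)
choose zero    _        = [ [] ]
choose (suc k) []       = []
choose (suc k) (x ∷ xs) = map (x ∷_) (choose k xs) ++ choose (suc k) xs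

sublists : {A : Set} → List A → List (List A)
sublists []       = [ [] ]
sublists (x ∷ xs) = map (x ∷_) (sublists xs) ++ sublists xs

pairsOf : {A : Set} → List A → List (A × A)
pairsOf []       = []
pairsOf (x ∷ xs) = map (x ,_) xs ++ pairsOf xs

filterᵇ : {A : Set} → (A → Bool) → List A → List A
filterᵇ p []       = []
filterᵇ p (x ∷ xs) = if p x then x ∷ filterᵇ p xs else filterᵇ p xs

cartesian : {A : Set} → List (List A) → List (List A)
cartesian []         = [ [] ]
cartesian (xs ∷ xss) = concatMap (λ x → map (x ∷_) (cartesian xss)) xs

Edge : ℕ → Set
Edge n = Fin n × Fin n

-- a graph on a vertex set S (S an increasing list of vertices) is given
-- by its edge set, a sublist of pairsOf S (edges written (i , j), i < j)

properGraphs : {n : ℕ} → List (Fin n) → List (List (Edge n))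
properGraphs S =
  filterᵇ (λ E → (0 <ᵇ length E) ∧ (length E <ᵇ length (pairsOf S)))
         (sublists (pairsOf S))

kSubsets : (n k : ℕ) → List (List (Fin n))
kSubsets n k = choose k (allFin n)

-- the set 𝒜 of assignments S ↦ 𝔤_S, enumerated as lists
-- (g_S listed in the order of kSubsets n k)
assignments : (n k : ℕ) → List (List (List (Edge n)))
assignments n k = cartesian (map properGraphs (kSubsets n k))

anyᵇ : {A : Set} → (A → Bool) → List A → Bool
anyᵇ p []       = false
anyᵇ p (x ∷ xs) = p x ∨ anyᵇ p xs

edgeEq : {n : ℕ} → Edge n → Edge n → Bool
edgeEq (a , b) (c , d) = ⌊ a Fin.≟ c ⌋ ∧ ⌊ b Fin.≟ d ⌋

numEdges : {n : ℕ} → List (List (Edge n)) → ℕ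
numEdges {n} g =
  length (filterᵇ (λ p → anyᵇ (λ E → anyᵇ (edgeEq p) E) g) (pairsOf (allFin n)))

negOnePow : ℕ → ℤ
negOnePow zero    = ℤ.1ℤ
negOnePow (suc m) = ℤ.- negOnePow m

sign : {n : ℕ} → List (List (Edge n)) → ℤ
sign g = foldr (λ E acc → negOnePow (length E) ℤ.* acc) ℤ.1ℤ g

sumℤ : List ℤ → ℤ
sumℤ = foldr ℤ._+_ ℤ.0ℤ

sumℚ : List ℚ → ℚ
sumℚ = foldr ℚ._+_ ℚ.0ℚ

coeffP : (n k m : ℕ) → ℤ
coeffP n k m =
  sumℤ (map (λ g → if numEdges g ≡ᵇ m then sign g else ℤ.0ℤ) (assignments n k))

IsZeroPoly : (n k : ℕ) → Set
IsZeroPoly n k = (m : ℕ) → coeffP n k m ≡ ℤ.0ℤ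

powℚ : ℚ → ℕ → ℚ
powℚ q zero    = ℚ.1ℚ
powℚ q (suc m) = q ℚ.* powℚ q m

evalP : (n k : ℕ) → ℚ → ℚ
evalP n k x =
  sumℚ (map (λ g → (sign g ℚ./ 1) ℚ.* powℚ x (numEdges g)) (assignments n k))

record SimpleGraph (n : ℕ) : Set where
  field
    adj    : Fin n → Fin n → Bool
    sym    : ∀ i j → adj i j ≡ adj j i
    irrefl : ∀ i → adj i i ≡ false
open SimpleGraph public

-- G contains a clique (b = true) / independent set (b = false) of size k
HasHomSet : {n : ℕ} → SimpleGraph n → Bool → ℕ → Set
HasHomSet {n} G b k =
  Data.Product.Σ (Subset n) λ S →
    (Data.Fin.Subset.∣ S ∣ ≡ k) ×
    (∀ i j → i ∈ S → j ∈ S → i ≢ j → adj G i j ≡ b)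

RamseyProp : ℕ → ℕ → Set
RamseyProp k n = (G : SimpleGraph n) → HasHomSet G true k Data.Sum.⊎ HasHomSet G false k
  where import Data.Sum

IsRamseyNumber : ℕ → ℕ → Set
IsRamseyNumber k r =
  (0 ℕ.< r) × RamseyProp k r × (∀ m → 0 ℕ.< m → RamseyProp k m → r ℕ.≤ m)

{-# OPTIONS --safe #-}

-- Encode a graph on [n] as the bit list G of its edges among the N = C(n,2) pairs.  For fixed G the
-- signed number of assignments 𝔤 with Edges(𝔤) ⊆ G factorises over the k-sets S, the factor of S
-- being the alternating sum over the proper graphs H on S with H ⊆ G.  Over all H ⊆ G|S the
-- alternating sum is [G|S has no edge]; removing H = ∅ and, as C(k,2) is odd, H = K_S leaves
-- [G|S is empty or complete] - 1.  So the signed count is ±1 when G is a Ramsey graph (no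
-- homogeneous k-set) and 0 otherwise.  Since t^|U| = Σ_{G ⊇ U} t^|G| (1-t)^(N-|G|), the polynomial
-- P_{n,k}(t) is the sum of these signed counts weighted by t^|G| (1-t)^(N-|G|): at t = 1/2 it is
-- ±2^-N times the number of Ramsey graphs on [n], and every coefficient vanishes once there are none.
-- Hence P_{n,k}(1/2) = 0 iff there is no Ramsey graph on [n] iff n ≥ R(k), and then P_{n,k} = 0.

module Submission where

open import Level using (0ℓ)
open import Algebra.Bundles using (CommutativeRing)
open import Algebra.Core using (Op₁; Op₂)
open import Algebra.Structures using (IsCommutativeRing)
open import Data.Bool using (Bool; true; false; not; _∧_; _∨_; if_then_else_; T)
open import Data.Bool.ListAction using (all)
open import Data.Bool.Properties using (∧-zeroʳ; ∨-zeroʳ; not-injective; if-float)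
open import Data.Fin as Fin using (Fin)
import Data.Fin.Properties as Fin
open import Data.Fin.Subset using (Subset; ∣_∣) renaming (_∈_ to _∈ₛ_)
open import Data.Integer as ℤ using (ℤ; -[1+_])
import Data.Integer.Properties as ℤₚ
open import Data.List using (List; []; _∷_; [_]; map; _++_; concatMap; foldr; length; downFrom; allFin)
import Data.List.Properties as List
open import Data.List.Membership.Propositional using (_∈_)
open import Data.List.Membership.Propositional.Properties
  using (∈-++⁻; ∈-++⁺ˡ; ∈-++⁺ʳ; ∈-map⁻; ∈-map⁺; ∈-allFin; ∈-downFrom⁻)
open import Data.List.Relation.Unary.Any using (here; there)
open import Data.Nat as ℕ using (ℕ; zero; suc; parity; _%_; _≤_; _<_; z≤n; s≤s; _≡ᵇ_; _<ᵇ_)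
import Data.Nat.Properties as ℕₚ
open import Data.Nat.Combinatorics using (_C_; nC1≡n; nCk+nC[k+1]≡[n+1]C[k+1])
import Data.Nat.Coprimality as Coprime
open import Data.Parity.Base as ℙ using (0ℙ; 1ℙ)
import Data.Parity.Properties as ℙₚ
open import Data.Product using (_×_; _,_; Σ-syntax)
import Data.Product
open import Data.Rational as ℚ using (ℚ; mkℚ; ½; 0ℚ; 1ℚ)
import Data.Rational.Properties as ℚₚ
open import Data.Sum using (_⊎_; inj₁; inj₂)
import Data.Sum
open import Data.Vec using ([]; _∷_; here; there)
open import Function using (_∘_; id)
open import Function.Bundles using (_⇔_; mk⇔)
open import Relation.Binary using (Tri; tri<; tri≈; tri>)
open import Relation.Binary.PropositionalEquality hiding ([_])
open import Relation.Nullary using (yes; no; contradiction)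
open import Relation.Nullary.Decidable using (⌊_⌋; isYes≗does; dec-true)

open import Defs hiding (sym)

≢⇒≡ᵇ≡false : ∀ {m n} → m ≢ n → (m ≡ᵇ n) ≡ false
≢⇒≡ᵇ≡false {m} {n} m≢n with m ≡ᵇ n in eq
... | true  = contradiction (ℕₚ.≡ᵇ⇒≡ m n (subst T (sym eq) _)) m≢n
... | false = refl

≡ᵇ-refl : ∀ m → (m ≡ᵇ m) ≡ true
≡ᵇ-refl zero    = refl
≡ᵇ-refl (suc m) = ≡ᵇ-refl m

bitLists : ℕ → List (List Bool)
bitLists zero    = [ [] ]
bitLists (suc N) = map (true ∷_) (bitLists N) ++ map (false ∷_) (bitLists N)

infix 4 _⊆ᵇ_
_⊆ᵇ_ : List Bool → List Bool → Bool
(c ∷ cs) ⊆ᵇ (b ∷ bs) = (not c ∨ b) ∧ (cs ⊆ᵇ bs)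
_        ⊆ᵇ _        = true

countTrue : List Bool → ℕ
countTrue []          = 0
countTrue (true ∷ c)  = suc (countTrue c)
countTrue (false ∷ c) = countTrue c

∈-bitLists : (bs : List Bool) → bs ∈ bitLists (length bs)
∈-bitLists []           = here refl
∈-bitLists (true ∷ bs)  = ∈-++⁺ˡ (∈-map⁺ (true ∷_) (∈-bitLists bs))
∈-bitLists (false ∷ bs) =
  ∈-++⁺ʳ (map (true ∷_) (bitLists (length bs))) (∈-map⁺ (false ∷_) (∈-bitLists bs))

properSublists : {A : Set} → List A → List (List A)
properSublists Q = filterᵇ (λ E → (0 <ᵇ length E) ∧ (length E <ᵇ length Q)) (sublists Q)

monochromatic : {A : Set} → (A → Bool) → List A → Bool
monochromatic m Q = all (not ∘ m) Q ∨ all m Q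

module _ {A B : Set} (f : A → B) where

  choose-map : ∀ k (xs : List A) → choose k (map f xs) ≡ map (map f) (choose k xs)
  choose-map zero    xs       = refl
  choose-map (suc k) []       = refl
  choose-map (suc k) (x ∷ xs) = begin
    map (f x ∷_) (choose k (map f xs)) ++ choose (suc k) (map f xs)
      ≡⟨ cong₂ _++_ (cong (map (f x ∷_)) (choose-map k xs)) (choose-map (suc k) xs) ⟩
    map (f x ∷_) (map (map f) (choose k xs)) ++ map (map f) (choose (suc k) xs)
      ≡⟨ cong (_++ _) (trans (sym (List.map-∘ (choose k xs))) (List.map-∘ (choose k xs))) ⟩
    map (map f) (map (x ∷_) (choose k xs)) ++ map (map f) (choose (suc k) xs)
      ≡⟨ List.map-++ (map f) (map (x ∷_) (choose k xs)) (choose (suc k) xs) ⟨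
    map (map f) (map (x ∷_) (choose k xs) ++ choose (suc k) xs) ∎
    where open ≡-Reasoning

  ∈-choose-map⁺ : ∀ k (xs : List A) {S} → S ∈ choose k xs → map f S ∈ choose k (map f xs)
  ∈-choose-map⁺ k xs {S} S∈ = subst (map f S ∈_) (sym (choose-map k xs)) (∈-map⁺ (map f) S∈)

  ∈-choose-map⁻ : ∀ k (xs : List A) {S} → S ∈ choose k (map f xs) →
                  Σ[ S′ ∈ List A ] (S′ ∈ choose k xs × map f S′ ≡ S)
  ∈-choose-map⁻ k xs S∈ with ∈-map⁻ (map f) (subst (_ ∈_) (choose-map k xs) S∈)
  ... | S′ , S′∈ , refl = S′ , S′∈ , refl

  pairsOf-map : (xs : List A) → pairsOf (map f xs) ≡ map (λ (a , b) → f a , f b) (pairsOf xs)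
  pairsOf-map []       = refl
  pairsOf-map (x ∷ xs) =
    trans (cong₂ _++_ (trans (sym (List.map-∘ xs)) (List.map-∘ xs)) (pairsOf-map xs))
          (sym (List.map-++ _ (map (x ,_) xs) (pairsOf xs)))

module _ {A : Set} where

  ∈-sublists⇒length≤ : (Q : List A) {E : List A} → E ∈ sublists Q → length E ≤ length Q
  ∈-sublists⇒length≤ []      (here refl) = z≤n
  ∈-sublists⇒length≤ (x ∷ Q) E∈ with ∈-++⁻ (map (x ∷_) (sublists Q)) E∈
  ... | inj₁ E∈₁ with ∈-map⁻ (x ∷_) E∈₁
  ...   | _ , E′∈ , refl = s≤s (∈-sublists⇒length≤ Q E′∈)
  ∈-sublists⇒length≤ (x ∷ Q) E∈ | inj₂ E∈₂ = ℕₚ.m≤n⇒m≤1+n (∈-sublists⇒length≤ Q E∈₂)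

  ∈-choose⇒length≡ : (k : ℕ) (xs : List A) {S : List A} → S ∈ choose k xs → length S ≡ k
  ∈-choose⇒length≡ zero    xs       (here refl) = refl
  ∈-choose⇒length≡ (suc k) (x ∷ xs) S∈ with ∈-++⁻ (map (x ∷_) (choose k xs)) S∈
  ... | inj₁ S∈₁ with ∈-map⁻ (x ∷_) S∈₁
  ...   | _ , S′∈ , refl = cong suc (∈-choose⇒length≡ k xs S′∈)
  ∈-choose⇒length≡ (suc k) (x ∷ xs) S∈ | inj₂ S∈₂ = ∈-choose⇒length≡ (suc k) xs S∈₂

  ∈-choose-∷⁺ : ∀ {x} k (xs : List A) {S} → S ∈ choose k xs → S ∈ choose k (x ∷ xs)
  ∈-choose-∷⁺         zero    xs S∈ = S∈
  ∈-choose-∷⁺ {x = x} (suc k) xs S∈ = ∈-++⁺ʳ (map (x ∷_) (choose k xs)) S∈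

  length-pairsOf : (S : List A) → length (pairsOf S) ≡ length S C 2
  length-pairsOf []      = refl
  length-pairsOf (x ∷ S) = begin
    length (map (x ,_) S ++ pairsOf S)              ≡⟨ List.length-++ (map (x ,_) S) ⟩
    length (map (x ,_) S) ℕ.+ length (pairsOf S)
      ≡⟨ cong₂ ℕ._+_ (List.length-map (x ,_) S) (length-pairsOf S) ⟩
    length S ℕ.+ length S C 2                       ≡⟨ cong (ℕ._+ length S C 2) (nC1≡n (length S)) ⟨
    length S C 1 ℕ.+ length S C 2                   ≡⟨ nCk+nC[k+1]≡[n+1]C[k+1] (length S) 1 ⟩
    suc (length S) C 2                              ∎
    where open ≡-Reasoning

  ∈-pairsOf⁻ : (xs : List A) {a b : A} → (a , b) ∈ pairsOf xs → a ∈ xs × b ∈ xs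
  ∈-pairsOf⁻ (x ∷ xs) ab∈ with ∈-++⁻ (map (x ,_) xs) ab∈
  ... | inj₁ ab∈₁ with ∈-map⁻ (x ,_) ab∈₁
  ...   | _ , b∈ , refl = here refl , there b∈
  ∈-pairsOf⁻ (x ∷ xs) ab∈ | inj₂ ab∈₂ = Data.Product.map there there (∈-pairsOf⁻ xs ab∈₂)

  ∈-pairsOf⁺ : (xs : List A) {a b : A} → a ∈ xs → b ∈ xs → a ≢ b →
               (a , b) ∈ pairsOf xs ⊎ (b , a) ∈ pairsOf xs
  ∈-pairsOf⁺ (x ∷ xs) (here refl) (here refl) a≢b = contradiction refl a≢b
  ∈-pairsOf⁺ (x ∷ xs) (here refl) (there b∈)  _   = inj₁ (∈-++⁺ˡ (∈-map⁺ (x ,_) b∈))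
  ∈-pairsOf⁺ (x ∷ xs) (there a∈)  (here refl) _   = inj₂ (∈-++⁺ˡ (∈-map⁺ (x ,_) a∈))
  ∈-pairsOf⁺ (x ∷ xs) (there a∈)  (there b∈)  a≢b =
    Data.Sum.map (∈-++⁺ʳ (map (x ,_) xs)) (∈-++⁺ʳ (map (x ,_) xs)) (∈-pairsOf⁺ xs a∈ b∈ a≢b)

  length-filterᵇ≤ : (f : A → Bool) (xs : List A) → length (filterᵇ f xs) ≤ length xs
  length-filterᵇ≤ f []       = z≤n
  length-filterᵇ≤ f (x ∷ xs) with f x
  ... | true  = s≤s (length-filterᵇ≤ f xs)
  ... | false = ℕₚ.m≤n⇒m≤1+n (length-filterᵇ≤ f xs)

  length-filterᵇ≡countTrue : (f : A → Bool) (xs : List A) → length (filterᵇ f xs) ≡ countTrue (map f xs)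
  length-filterᵇ≡countTrue f []       = refl
  length-filterᵇ≡countTrue f (x ∷ xs) with f x
  ... | true  = cong suc (length-filterᵇ≡countTrue f xs)
  ... | false = length-filterᵇ≡countTrue f xs

  countTrue-map≡0 : (f : A → Bool) (xs : List A) → countTrue (map f xs) ≡ 0 →
                    ∀ {x} → x ∈ xs → f x ≡ false
  countTrue-map≡0 f (y ∷ xs) none y∈ with f y in fy
  countTrue-map≡0 f (y ∷ xs) none (here refl) | false = fy
  countTrue-map≡0 f (y ∷ xs) none (there x∈)  | false = countTrue-map≡0 f xs none x∈

  all-cong : {f h : A → Bool} (xs : List A) → (∀ x → f x ≡ h x) → all f xs ≡ all h xs
  all-cong []       f≡h = refl
  all-cong (x ∷ xs) f≡h = cong₂ _∧_ (f≡h x) (all-cong xs f≡h)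

  all-const-true : (xs : List A) → all (λ _ → true) xs ≡ true
  all-const-true []       = refl
  all-const-true (x ∷ xs) = all-const-true xs

  all-∧ : (f h : A → Bool) (xs : List A) → all (λ x → f x ∧ h x) xs ≡ all f xs ∧ all h xs
  all-∧ f h []       = refl
  all-∧ f h (x ∷ xs) with f x | h x
  ... | true  | true  = all-∧ f h xs
  ... | true  | false = sym (∧-zeroʳ _)
  ... | false | _     = refl

  all-not-∨ : (f : A → Bool) (b : Bool) (xs : List A) →
              all (λ x → not (f x) ∨ b) xs ≡ not (anyᵇ f xs) ∨ b
  all-not-∨ f b []       = refl
  all-not-∨ f b (x ∷ xs) with f x
  ... | false = all-not-∨ f b xs
  ... | true  with b
  ...   | true  = trans (all-not-∨ f true xs) (∨-zeroʳ _)
  ...   | false = refl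

  all-true⁺ : (p : A → Bool) (xs : List A) → (∀ {x} → x ∈ xs → p x ≡ true) → all p xs ≡ true
  all-true⁺ p []       _   = refl
  all-true⁺ p (x ∷ xs) p≡true rewrite p≡true (here refl) = all-true⁺ p xs (p≡true ∘ there)

  all-true⁻ : (p : A → Bool) (xs : List A) → all p xs ≡ true → ∀ {x} → x ∈ xs → p x ≡ true
  all-true⁻ p (y ∷ xs) eq (here refl) with p y | eq
  ... | true  | _  = refl
  ... | false | ()
  all-true⁻ p (y ∷ xs) eq (there x∈) with p y | eq
  ... | true  | eq′ = all-true⁻ p xs eq′ x∈
  ... | false | ()

  all-false⁺ : (p : A → Bool) (xs : List A) {x : A} → x ∈ xs → p x ≡ false → all p xs ≡ false
  all-false⁺ p (x ∷ xs) (here refl) px≡false rewrite px≡false = refl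
  all-false⁺ p (y ∷ xs) (there x∈)  px≡false rewrite all-false⁺ p xs x∈ px≡false = ∧-zeroʳ (p y)

  all-false⁻ : (p : A → Bool) (xs : List A) → all p xs ≡ false → Σ[ x ∈ A ] (x ∈ xs × p x ≡ false)
  all-false⁻ p (y ∷ xs) eq with p y in py
  ... | false = y , here refl , py
  ... | true with all-false⁻ p xs eq
  ...   | x , x∈ , px = x , there x∈ , px

  monochromatic⁺ : (m : A → Bool) (Q : List A) (b : Bool) → (∀ {x} → x ∈ Q → m x ≡ b) →
                   monochromatic m Q ≡ true
  monochromatic⁺ m Q true  m≡b = trans (cong (all (not ∘ m) Q ∨_) (all-true⁺ m Q m≡b)) (∨-zeroʳ _)
  monochromatic⁺ m Q false m≡b = cong (_∨ all m Q) (all-true⁺ (not ∘ m) Q (cong not ∘ m≡b))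

  monochromatic⁻ : (m : A → Bool) (Q : List A) → monochromatic m Q ≡ true →
                   Σ[ b ∈ Bool ] (∀ {x} → x ∈ Q → m x ≡ b)
  monochromatic⁻ m Q mono with all (not ∘ m) Q in none | all m Q in every
  ... | true  | _    = false , λ x∈ → not-injective {y = false} (all-true⁻ (not ∘ m) Q none x∈)
  ... | false | true = true , all-true⁻ m Q every

-- Parity of C(k,2)

[1+n]C2≡n+nC2 : ∀ n → suc n C 2 ≡ n ℕ.+ n C 2
[1+n]C2≡n+nC2 n = trans (sym (nCk+nC[k+1]≡[n+1]C[k+1] n 1)) (cong (ℕ._+ n C 2) (nC1≡n n))

2≤n⇒0<nC2 : ∀ {n} → 2 ≤ n → 0 < n C 2
2≤n⇒0<nC2 {suc zero}    (s≤s ())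
2≤n⇒0<nC2 {suc (suc n)} _ = subst (0 <_) (sym ([1+n]C2≡n+nC2 (suc n))) (s≤s z≤n)

parity-[1+n]C2 : ∀ n → parity (suc n C 2) ≡ parity n ℙ.+ parity (n C 2)
parity-[1+n]C2 n = trans (cong parity ([1+n]C2≡n+nC2 n)) (ℙₚ.+-homo-+ n (n C 2))

parity-[4+n]C2 : ∀ n → parity ((4 ℕ.+ n) C 2) ≡ parity (n C 2)
parity-[4+n]C2 n = begin
  parity ((4 ℕ.+ n) C 2)                  ≡⟨ parity-[1+n]C2 (3 ℕ.+ n) ⟩
  a ℙ.+ parity ((3 ℕ.+ n) C 2)            ≡⟨ cong (a ℙ.+_) (parity-[1+n]C2 (2 ℕ.+ n)) ⟩
  a ℙ.+ (b ℙ.+ parity ((2 ℕ.+ n) C 2))    ≡⟨ cong (λ p → a ℙ.+ (b ℙ.+ p)) (parity-[1+n]C2 (1 ℕ.+ n)) ⟩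
  a ℙ.+ (b ℙ.+ (a ℙ.+ parity ((1 ℕ.+ n) C 2)))
    ≡⟨ cong (λ p → a ℙ.+ (b ℙ.+ (a ℙ.+ p))) (parity-[1+n]C2 n) ⟩
  a ℙ.+ (b ℙ.+ (a ℙ.+ (b ℙ.+ parity (n C 2))))
    ≡⟨ x+[y+[x+[y+t]]]≡t a b (parity (n C 2)) ⟩
  parity (n C 2)                          ∎
  where
  open ≡-Reasoning
  a b : ℙ.Parity
  a = parity (1 ℕ.+ n)
  b = parity n
  x+[y+[x+[y+t]]]≡t : ∀ x y t → x ℙ.+ (y ℙ.+ (x ℙ.+ (y ℙ.+ t))) ≡ t
  x+[y+[x+[y+t]]]≡t 0ℙ 0ℙ t  = refl
  x+[y+[x+[y+t]]]≡t 0ℙ 1ℙ 0ℙ = refl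
  x+[y+[x+[y+t]]]≡t 0ℙ 1ℙ 1ℙ = refl
  x+[y+[x+[y+t]]]≡t 1ℙ 0ℙ 0ℙ = refl
  x+[y+[x+[y+t]]]≡t 1ℙ 0ℙ 1ℙ = refl
  x+[y+[x+[y+t]]]≡t 1ℙ 1ℙ 0ℙ = refl
  x+[y+[x+[y+t]]]≡t 1ℙ 1ℙ 1ℙ = refl

parity-C2-odd : ∀ k → k % 4 ≡ 2 ⊎ k % 4 ≡ 3 → parity (k C 2) ≡ 1ℙ
parity-C2-odd 0                         (inj₁ ())
parity-C2-odd 0                         (inj₂ ())
parity-C2-odd 1                         (inj₁ ())
parity-C2-odd 1                         (inj₂ ())
parity-C2-odd 2                         _ = refl
parity-C2-odd 3                         _ = refl
parity-C2-odd (suc (suc (suc (suc k)))) h = trans (parity-[4+n]C2 k) (parity-C2-odd k h)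

-- Graphs as bit lists

allPairs : (n : ℕ) → List (Edge n)
allPairs n = pairsOf (allFin n)

graphs : ℕ → List (List Bool)
graphs n = bitLists (length (allPairs n))

isEdgeOf : ∀ {n} → List (List (Edge n)) → Edge n → Bool
isEdgeOf g p = anyᵇ (anyᵇ (edgeEq p)) g

edgeBits : ∀ {n} → List (List (Edge n)) → List Bool
edgeBits {n} g = map (isEdgeOf g) (allPairs n)

-- The bit of e in the bit list G indexed by ps; junk value true when e ∉ ps.
hasEdge : ∀ {n} → List (Edge n) → List Bool → Edge n → Bool
hasEdge (p ∷ ps) (b ∷ bs) e = (not (edgeEq p e) ∨ b) ∧ hasEdge ps bs e
hasEdge _        _        e = true

monochromaticIn : ∀ {n} → List Bool → List (Fin n) → Bool
monochromaticIn {n} G S = monochromatic (hasEdge (allPairs n) G) (pairsOf S)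

isRamseyGraph : (n k : ℕ) → List Bool → Bool
isRamseyGraph n k G = all (not ∘ monochromaticIn G) (kSubsets n k)

numEdges≡countTrue-edgeBits : ∀ {n} (g : List (List (Edge n))) → numEdges g ≡ countTrue (edgeBits g)
numEdges≡countTrue-edgeBits {n} g = length-filterᵇ≡countTrue (isEdgeOf g) (allPairs n)

map-isEdgeOf-⊆ᵇ : ∀ {n} (g : List (List (Edge n))) ps bs →
  (map (isEdgeOf g) ps ⊆ᵇ bs) ≡ all (all (hasEdge ps bs)) g
map-isEdgeOf-⊆ᵇ g []       bs       = sym (trans (all-cong g all-const-true) (all-const-true g))
map-isEdgeOf-⊆ᵇ g (p ∷ ps) []       = sym (trans (all-cong g all-const-true) (all-const-true g))
map-isEdgeOf-⊆ᵇ g (p ∷ ps) (b ∷ bs) = sym (begin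
  all (all (λ e → (not (edgeEq p e) ∨ b) ∧ hasEdge ps bs e)) g
    ≡⟨ all-cong g (λ E → all-∧ _ _ E) ⟩
  all (λ E → all (λ e → not (edgeEq p e) ∨ b) E ∧ all (hasEdge ps bs) E) g
    ≡⟨ all-∧ _ _ g ⟩
  all (all (λ e → not (edgeEq p e) ∨ b)) g ∧ all (all (hasEdge ps bs)) g
    ≡⟨ cong₂ _∧_ (trans (all-cong g (all-not-∨ (edgeEq p) b)) (all-not-∨ (anyᵇ (edgeEq p)) b g))
                 (sym (map-isEdgeOf-⊆ᵇ g ps bs)) ⟩
  (not (isEdgeOf g p) ∨ b) ∧ (map (isEdgeOf g) ps ⊆ᵇ bs) ∎)
  where open ≡-Reasoning

edgeEq-refl : ∀ {n} (e : Edge n) → edgeEq e e ≡ true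
edgeEq-refl (a , b) = cong₂ _∧_ (⌊≟⌋-refl a) (⌊≟⌋-refl b)
  where
  ⌊≟⌋-refl : (x : Fin _) → ⌊ x Fin.≟ x ⌋ ≡ true
  ⌊≟⌋-refl x = trans (isYes≗does (x Fin.≟ x)) (dec-true (x Fin.≟ x) refl)

edgeEq⇒≡ : ∀ {n} (p e : Edge n) → edgeEq p e ≡ true → p ≡ e
edgeEq⇒≡ (a , b) (c , d) eq with a Fin.≟ c | b Fin.≟ d | eq
... | yes refl | yes refl | _ = refl
... | yes _    | no _     | ()
... | no _     | _        | ()

module _ {n : ℕ} (f : Edge n → Bool) where

  hasEdge-map-true : (ps : List (Edge n)) {e : Edge n} → f e ≡ true → hasEdge ps (map f ps) e ≡ true
  hasEdge-map-true []           _  = refl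
  hasEdge-map-true (p ∷ ps) {e} fe with edgeEq p e in p≈e
  ... | false = hasEdge-map-true ps fe
  ... | true rewrite edgeEq⇒≡ p e p≈e | fe = hasEdge-map-true ps fe

  hasEdge-map : (ps : List (Edge n)) {e : Edge n} → e ∈ ps → hasEdge ps (map f ps) e ≡ f e
  hasEdge-map (p ∷ ps) {e} e∈ with f e in fe
  ... | true = hasEdge-map-true (p ∷ ps) fe
  hasEdge-map (p ∷ ps) (here refl) | false rewrite edgeEq-refl p | fe = refl
  hasEdge-map (p ∷ ps) (there e∈)  | false rewrite trans (hasEdge-map ps e∈) fe = ∧-zeroʳ _

  adjacency : Fin n → Fin n → Bool
  adjacency i j with Fin.<-cmp i j
  ... | tri< _ _ _ = f (i , j)
  ... | tri≈ _ _ _ = false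
  ... | tri> _ _ _ = f (j , i)

  adjacency-< : ∀ {i j} → i Fin.< j → adjacency i j ≡ f (i , j)
  adjacency-< {i} {j} i<j with Fin.<-cmp i j
  ... | tri< _ _   _   = refl
  ... | tri≈ _ i≡j _   = contradiction i<j (Fin.<-irrefl i≡j)
  ... | tri> _ _   j<i = contradiction i<j (Fin.<-asym j<i)

  adjacency-> : ∀ {i j} → j Fin.< i → adjacency i j ≡ f (j , i)
  adjacency-> {i} {j} j<i with Fin.<-cmp i j
  ... | tri< i<j _   _ = contradiction i<j (Fin.<-asym j<i)
  ... | tri≈ _   i≡j _ = contradiction j<i (Fin.<-irrefl (sym i≡j))
  ... | tri> _   _   _ = refl

  adjacency-sym : ∀ i j → adjacency i j ≡ adjacency j i
  adjacency-sym i j = by-trichotomy (Fin.<-cmp i j)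
    where
    by-trichotomy : Tri (i Fin.< j) (i ≡ j) (j Fin.< i) → adjacency i j ≡ adjacency j i
    by-trichotomy (tri< i<j _   _)   = trans (adjacency-< i<j) (sym (adjacency-> i<j))
    by-trichotomy (tri≈ _   i≡j _)   = cong₂ adjacency i≡j (sym i≡j)
    by-trichotomy (tri> _   _   j<i) = trans (adjacency-> j<i) (sym (adjacency-< j<i))

  adjacency-irrefl : ∀ i → adjacency i i ≡ false
  adjacency-irrefl i with Fin.<-cmp i i
  ... | tri< i<i _ _   = contradiction i<i (Fin.<-irrefl refl)
  ... | tri≈ _   _ _   = refl
  ... | tri> _   _ i<i = contradiction i<i (Fin.<-irrefl refl)

  toSimpleGraph : SimpleGraph n
  toSimpleGraph = record { adj = adjacency ; sym = adjacency-sym ; irrefl = adjacency-irrefl }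

-- The Ramsey property

allFin-suc : ∀ n → allFin (suc n) ≡ Fin.zero ∷ map Fin.suc (allFin n)
allFin-suc n = cong (Fin.zero ∷_) (sym (List.map-tabulate id Fin.suc))

members : ∀ {n} → Subset n → List (Fin n)
members []          = []
members (true ∷ v)  = Fin.zero ∷ map Fin.suc (members v)
members (false ∷ v) = map Fin.suc (members v)

∈-members⁺ : ∀ {n} (v : Subset n) {i : Fin n} → i ∈ₛ v → i ∈ members v
∈-members⁺ (true ∷ v)  here       = here refl
∈-members⁺ (true ∷ v)  (there i∈) = there (∈-map⁺ Fin.suc (∈-members⁺ v i∈))
∈-members⁺ (false ∷ v) (there i∈) = ∈-map⁺ Fin.suc (∈-members⁺ v i∈)

∈-members⁻ : ∀ {n} (v : Subset n) {i : Fin n} → i ∈ members v → i ∈ₛ v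
∈-members⁻ (true ∷ v)  (here refl) = here
∈-members⁻ (true ∷ v)  (there i∈) with ∈-map⁻ Fin.suc i∈
... | _ , j∈ , refl = there (∈-members⁻ v j∈)
∈-members⁻ (false ∷ v) i∈ with ∈-map⁻ Fin.suc i∈
... | _ , j∈ , refl = there (∈-members⁻ v j∈)

members∈choose : ∀ {n} (v : Subset n) → members v ∈ choose ∣ v ∣ (allFin n)
members∈choose         []          = here refl
members∈choose {suc n} (true ∷ v)  =
  subst (λ L → members (true ∷ v) ∈ choose (suc ∣ v ∣) L) (sym (allFin-suc n))
    (∈-++⁺ˡ (∈-map⁺ (Fin.zero ∷_) (∈-choose-map⁺ Fin.suc ∣ v ∣ (allFin n) (members∈choose v))))
members∈choose {suc n} (false ∷ v) =
  subst (λ L → members (false ∷ v) ∈ choose ∣ v ∣ L) (sym (allFin-suc n))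
    (∈-choose-∷⁺ ∣ v ∣ _ (∈-choose-map⁺ Fin.suc ∣ v ∣ (allFin n) (members∈choose v)))

choose⇒members : ∀ {n} k {S : List (Fin n)} → S ∈ choose k (allFin n) →
                 Σ[ v ∈ Subset n ] (∣ v ∣ ≡ k × members v ≡ S)
choose⇒members {zero}  zero    (here refl) = [] , refl , refl
choose⇒members {suc n} zero    (here refl) with choose⇒members {n} zero (here refl)
... | v , |v|≡0 , members≡[] = false ∷ v , |v|≡0 , cong (map Fin.suc) members≡[]
choose⇒members {suc n} (suc k) {S} S∈
  with ∈-++⁻ (map (Fin.zero ∷_) (choose k (map Fin.suc (allFin n))))
             (subst (λ L → S ∈ choose (suc k) L) (allFin-suc n) S∈)
... | inj₁ S∈₁ with ∈-map⁻ (Fin.zero ∷_) S∈₁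
...   | _ , E∈ , refl with ∈-choose-map⁻ Fin.suc k (allFin n) E∈
...     | E′ , E′∈ , refl with choose⇒members k E′∈
...       | v , |v|≡k , refl = true ∷ v , cong suc |v|≡k , refl
choose⇒members {suc n} (suc k) {S} S∈ | inj₂ S∈₂ with ∈-choose-map⁻ Fin.suc (suc k) (allFin n) S∈₂
...   | E′ , E′∈ , refl with choose⇒members (suc k) E′∈
...     | v , |v|≡k , refl = false ∷ v , |v|≡k , refl

pairsOf-members-< : ∀ {n} (v : Subset n) {i j : Fin n} → (i , j) ∈ pairsOf (members v) → i Fin.< j
pairsOf-map-suc-members-< : ∀ {n} (v : Subset n) {i j : Fin (suc n)} →
                            (i , j) ∈ pairsOf (map Fin.suc (members v)) → i Fin.< j

pairsOf-members-< (true ∷ v) ij∈ with ∈-++⁻ (map (Fin.zero ,_) (map Fin.suc (members v))) ij∈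
... | inj₁ ij∈₁ with ∈-map⁻ (Fin.zero ,_) ij∈₁
...   | _ , j∈ , refl with ∈-map⁻ Fin.suc j∈
...     | _ , _ , refl = s≤s z≤n
pairsOf-members-< (true ∷ v)  ij∈ | inj₂ ij∈₂ = pairsOf-map-suc-members-< v ij∈₂
pairsOf-members-< (false ∷ v) ij∈ = pairsOf-map-suc-members-< v ij∈

pairsOf-map-suc-members-< v ij∈ with ∈-map⁻ _ (subst (_ ∈_) (pairsOf-map Fin.suc (members v)) ij∈)
... | _ , ab∈ , refl = s≤s (pairsOf-members-< v ab∈)

<⇒∈allPairs : ∀ {n} {i j : Fin n} → i Fin.< j → (i , j) ∈ allPairs n
<⇒∈allPairs {suc n} {Fin.zero} {Fin.suc j} _ =
  subst (λ L → (Fin.zero , Fin.suc j) ∈ pairsOf L) (sym (allFin-suc n))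
    (∈-++⁺ˡ (∈-map⁺ (Fin.zero ,_) (∈-map⁺ Fin.suc (∈-allFin j))))
<⇒∈allPairs {suc n} {Fin.suc i} {Fin.suc j} (s≤s i<j) =
  subst (λ L → (Fin.suc i , Fin.suc j) ∈ pairsOf L) (sym (allFin-suc n))
    (∈-++⁺ʳ (map (Fin.zero ,_) (map Fin.suc (allFin n)))
      (subst ((Fin.suc i , Fin.suc j) ∈_) (sym (pairsOf-map Fin.suc (allFin n)))
        (∈-map⁺ _ (<⇒∈allPairs i<j))))

dropVertex₀ : ∀ {m} → SimpleGraph (suc m) → SimpleGraph m
dropVertex₀ G = record { adj    = λ i j → adj G (Fin.suc i) (Fin.suc j)
                       ; sym    = λ i j → SimpleGraph.sym G (Fin.suc i) (Fin.suc j)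
                       ; irrefl = λ i → irrefl G (Fin.suc i) }

HasHomSet-dropVertex₀ : ∀ {m b k} (G : SimpleGraph (suc m)) → HasHomSet (dropVertex₀ G) b k → HasHomSet G b k
HasHomSet-dropVertex₀ {b = b} G (v , |v|≡k , hom) = false ∷ v , |v|≡k , hom′
  where
  hom′ : ∀ i j → i ∈ₛ (false ∷ v) → j ∈ₛ (false ∷ v) → i ≢ j → adj G i j ≡ b
  hom′ (Fin.suc i) (Fin.suc j) (there i∈) (there j∈) i≢j = hom i j i∈ j∈ (i≢j ∘ cong Fin.suc)

HasHomSet⇒⊎ : ∀ {n k} {G : SimpleGraph n} → Σ[ b ∈ Bool ] HasHomSet G b k →
              HasHomSet G true k ⊎ HasHomSet G false k
HasHomSet⇒⊎ (true  , hom) = inj₁ hom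
HasHomSet⇒⊎ (false , hom) = inj₂ hom

RamseyProp-suc : ∀ {k m} → RamseyProp k m → RamseyProp k (suc m)
RamseyProp-suc ramsey G =
  Data.Sum.map (HasHomSet-dropVertex₀ G) (HasHomSet-dropVertex₀ G) (ramsey (dropVertex₀ G))

RamseyProp-mono : ∀ {k r n} → r ℕ.≤′ n → RamseyProp k r → RamseyProp k n
RamseyProp-mono ℕ.≤′-refl        = id
RamseyProp-mono (ℕ.≤′-step r≤′n) = RamseyProp-suc ∘ RamseyProp-mono r≤′n

module _ (n k : ℕ) where

  HasMonochromatic : List Bool → Set
  HasMonochromatic G = Σ[ S ∈ List (Fin n) ] (S ∈ kSubsets n k × monochromaticIn G S ≡ true)

  isRamseyGraph≡false⇒HasMonochromatic : ∀ G → isRamseyGraph n k G ≡ false → HasMonochromatic G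
  isRamseyGraph≡false⇒HasMonochromatic G notRamsey with all-false⁻ _ (kSubsets n k) notRamsey
  ... | S , S∈ , notMono = S , S∈ , not-injective {y = true} notMono

  HasMonochromatic⇒isRamseyGraph≡false : ∀ G → HasMonochromatic G → isRamseyGraph n k G ≡ false
  HasMonochromatic⇒isRamseyGraph≡false G (S , S∈ , mono) = all-false⁺ _ (kSubsets n k) S∈ (cong not mono)

  HasHomSet⇒HasMonochromatic : ∀ G {b} → HasHomSet (toSimpleGraph (hasEdge (allPairs n) G)) b k →
                               HasMonochromatic G
  HasHomSet⇒HasMonochromatic G {b} (v , |v|≡k , hom) =
    members v ,
    subst (λ k → members v ∈ choose k (allFin n)) |v|≡k (members∈choose v) ,
    monochromatic⁺ inG (pairsOf (members v)) b onPair
    where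
    inG : Edge n → Bool
    inG = hasEdge (allPairs n) G
    onPair : ∀ {e} → e ∈ pairsOf (members v) → inG e ≡ b
    onPair {i , j} ij∈ with ∈-pairsOf⁻ (members v) ij∈ | pairsOf-members-< v ij∈
    ... | i∈ , j∈ | i<j =
      trans (sym (adjacency-< inG i<j)) (hom i j (∈-members⁻ v i∈) (∈-members⁻ v j∈) (Fin.<⇒≢ i<j))

  module _ (Γ : SimpleGraph n) where

    adjacencyBits : List Bool
    adjacencyBits = map (λ (i , j) → adj Γ i j) (allPairs n)

    adjacencyBits∈graphs : adjacencyBits ∈ graphs n
    adjacencyBits∈graphs =
      subst (λ N → adjacencyBits ∈ bitLists N) (List.length-map _ (allPairs n)) (∈-bitLists adjacencyBits)

    HasMonochromatic⇒HasHomSet : HasMonochromatic adjacencyBits → Σ[ b ∈ Bool ] HasHomSet Γ b k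
    HasMonochromatic⇒HasHomSet (S , S∈ , mono) with choose⇒members k S∈
    ... | v , |v|≡k , refl with monochromatic⁻ _ _ mono
    ...   | b , onPair = b , v , |v|≡k , hom
      where
      onPair′ : ∀ {i j} → (i , j) ∈ pairsOf (members v) → adj Γ i j ≡ b
      onPair′ ij∈ =
        trans (sym (hasEdge-map _ (allPairs n) (<⇒∈allPairs (pairsOf-members-< v ij∈)))) (onPair ij∈)
      hom : ∀ i j → i ∈ₛ v → j ∈ₛ v → i ≢ j → adj Γ i j ≡ b
      hom i j i∈ j∈ i≢j with ∈-pairsOf⁺ (members v) (∈-members⁺ v i∈) (∈-members⁺ v j∈) i≢j
      ... | inj₁ ij∈ = onPair′ ij∈
      ... | inj₂ ji∈ = trans (SimpleGraph.sym Γ i j) (onPair′ ji∈)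

  RamseyProp⇒¬isRamseyGraph : RamseyProp k n → ∀ G → isRamseyGraph n k G ≡ false
  RamseyProp⇒¬isRamseyGraph ramsey G =
    HasMonochromatic⇒isRamseyGraph≡false G
      (Data.Sum.[ HasHomSet⇒HasMonochromatic G , HasHomSet⇒HasMonochromatic G ]′
         (ramsey (toSimpleGraph (hasEdge (allPairs n) G))))

  ¬isRamseyGraph⇒RamseyProp : (∀ G → G ∈ graphs n → isRamseyGraph n k G ≡ false) → RamseyProp k n
  ¬isRamseyGraph⇒RamseyProp none Γ =
    HasHomSet⇒⊎ {G = Γ} (HasMonochromatic⇒HasHomSet Γ (isRamseyGraph≡false⇒HasMonochromatic G (none G G∈)))
    where
    G : List Bool
    G = adjacencyBits Γ
    G∈ : G ∈ graphs n
    G∈ = adjacencyBits∈graphs Γ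

-- Sums and products in a commutative ring

module BigOperators {R : Set} {add mul : Op₂ R} { -_ : Op₁ R} {0# 1# : R}
                    (isCommutativeRing : IsCommutativeRing _≡_ add mul -_ 0# 1#) where

  open IsCommutativeRing isCommutativeRing public
    using (+-assoc; +-identityˡ; +-identityʳ; -‿inverseˡ; -‿inverseʳ;
           *-assoc; *-comm; *-identityˡ; *-identityʳ; zeroˡ; zeroʳ; distribˡ; distribʳ)

  private
    commutativeRing : CommutativeRing 0ℓ 0ℓ
    commutativeRing = record { isCommutativeRing = isCommutativeRing }
    open CommutativeRing commutativeRing
      using (ring; semiring; +-commutativeSemigroup; *-commutativeSemigroup)

  open CommutativeRing commutativeRing public using (_+_; _*_)
  open import Algebra.Properties.Ring ring public
    using (-‿involutive; -‿anti-homo-+; -‿distribˡ-*; -‿distribʳ-*; -1*x≈-x; xyx⁻¹≈y)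
  open import Algebra.Properties.CommutativeSemigroup +-commutativeSemigroup public
    using () renaming (interchange to +-interchange)
  open import Algebra.Properties.CommutativeSemigroup *-commutativeSemigroup public
    using () renaming (interchange to *-interchange; x∙yz≈y∙xz to x*yz≡y*xz)
  open import Algebra.Properties.Semiring.Exp semiring public using (_^_)

  ∑ ∏ : {A : Set} → List A → (A → R) → R
  ∑ xs f = foldr _+_ 0# (map f xs)
  ∏ xs f = foldr _*_ 1# (map f xs)

  infix 5 ∑ ∏
  syntax ∑ xs (λ x → e) = ∑[ x ∈ xs ] e
  syntax ∏ xs (λ x → e) = ∏[ x ∈ xs ] e

  ⟦_⟧ : Bool → R
  ⟦ true  ⟧ = 1#
  ⟦ false ⟧ = 0#

  -1^_ : ℕ → R
  -1^ zero  = 1#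
  -1^ suc m = - (-1^ m)

  if-then-0# : ∀ b x → (if b then x else 0#) ≡ x * ⟦ b ⟧
  if-then-0# true  x = sym (*-identityʳ x)
  if-then-0# false x = sym (zeroʳ x)

  -1^-odd : ∀ m → parity m ≡ 1ℙ → -1^ m ≡ - 1#
  -1^-odd 1             _   = refl
  -1^-odd (suc (suc m)) odd = trans (-‿involutive _) (-1^-odd m odd)

  -1^-*-self : ∀ m → -1^ m * -1^ m ≡ 1#
  -1^-*-self zero    = *-identityˡ 1#
  -1^-*-self (suc m) = begin
    - (-1^ m) * - (-1^ m)  ≡⟨ -‿distribˡ-* _ _ ⟨
    - (-1^ m * - (-1^ m))  ≡⟨ cong -_ (-‿distribʳ-* _ _) ⟨
    - - (-1^ m * -1^ m)    ≡⟨ -‿involutive _ ⟩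
    -1^ m * -1^ m          ≡⟨ -1^-*-self m ⟩
    1#                     ∎
    where open ≡-Reasoning

  ^-inverse : ∀ {u v} → v * u ≡ 1# → ∀ N → v ^ N * u ^ N ≡ 1#
  ^-inverse vu≡1 zero    = *-identityˡ 1#
  ^-inverse vu≡1 (suc N) =
    trans (*-interchange _ _ _ _) (trans (cong₂ _*_ vu≡1 (^-inverse vu≡1 N)) (*-identityˡ 1#))

  inverse-*-≡0⇒≡0 : ∀ {u v x} → u * v ≡ 1# → v * x ≡ 0# → x ≡ 0#
  inverse-*-≡0⇒≡0 {u} {v} {x} uv≡1 vx≡0 = begin
    x            ≡⟨ *-identityˡ x ⟨
    1# * x       ≡⟨ cong (_* x) uv≡1 ⟨
    u * v * x    ≡⟨ *-assoc u v x ⟩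
    u * (v * x)  ≡⟨ cong (u *_) vx≡0 ⟩
    u * 0#       ≡⟨ zeroʳ u ⟩
    0#           ∎
    where open ≡-Reasoning

  x+[1-b]≡a⇒x≡a+b-1 : ∀ {x a b} → x + (1# + - b) ≡ a → x ≡ a + b + - 1#
  x+[1-b]≡a⇒x≡a+b-1 {x} {a} {b} eq = begin
    x                                   ≡⟨ +-identityʳ x ⟨
    x + 0#                              ≡⟨ cong (x +_) (-‿inverseʳ (1# + - b)) ⟨
    x + ((1# + - b) + - (1# + - b))     ≡⟨ +-assoc x _ _ ⟨
    x + (1# + - b) + - (1# + - b)       ≡⟨ cong₂ _+_ eq (-‿anti-homo-+ 1# (- b)) ⟩
    a + (- - b + - 1#)                  ≡⟨ cong (λ y → a + (y + - 1#)) (-‿involutive b) ⟩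
    a + (b + - 1#)                      ≡⟨ +-assoc a b _ ⟨
    a + b + - 1#                        ∎
    where open ≡-Reasoning

  module _ {A : Set} where

    ∑-++ : (xs ys : List A) (f : A → R) → ∑ (xs ++ ys) f ≡ ∑ xs f + ∑ ys f
    ∑-++ []       ys f = sym (+-identityˡ _)
    ∑-++ (x ∷ xs) ys f = trans (cong (f x +_) (∑-++ xs ys f)) (sym (+-assoc _ _ _))

    ∑-cong : (xs : List A) {f g : A → R} → (∀ {x} → x ∈ xs → f x ≡ g x) → ∑ xs f ≡ ∑ xs g
    ∑-cong []       f≡g = refl
    ∑-cong (x ∷ xs) f≡g = cong₂ _+_ (f≡g (here refl)) (∑-cong xs (f≡g ∘ there))

    ∏-cong : (xs : List A) {f g : A → R} → (∀ {x} → x ∈ xs → f x ≡ g x) → ∏ xs f ≡ ∏ xs g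
    ∏-cong []       f≡g = refl
    ∏-cong (x ∷ xs) f≡g = cong₂ _*_ (f≡g (here refl)) (∏-cong xs (f≡g ∘ there))

    ∑-zero : (xs : List A) → ∑[ x ∈ xs ] 0# ≡ 0#
    ∑-zero []       = refl
    ∑-zero (x ∷ xs) = trans (+-identityˡ _) (∑-zero xs)

    ∑-*-zeroʳ : (xs : List A) (f : A → R) → ∑[ x ∈ xs ] f x * 0# ≡ 0#
    ∑-*-zeroʳ xs f = trans (∑-cong xs (λ {x} _ → zeroʳ (f x))) (∑-zero xs)

    ∑-distrib-+ : (xs : List A) (f g : A → R) → ∑[ x ∈ xs ] (f x + g x) ≡ ∑ xs f + ∑ xs g
    ∑-distrib-+ []       f g = sym (+-identityˡ _)
    ∑-distrib-+ (x ∷ xs) f g =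
      trans (cong (f x + g x +_) (∑-distrib-+ xs f g)) (+-interchange _ _ _ _)

    ∏-distrib-* : (xs : List A) (f g : A → R) → ∏[ x ∈ xs ] (f x * g x) ≡ ∏ xs f * ∏ xs g
    ∏-distrib-* []       f g = sym (*-identityˡ _)
    ∏-distrib-* (x ∷ xs) f g =
      trans (cong (f x * g x *_) (∏-distrib-* xs f g)) (*-interchange _ _ _ _)

    *-distribˡ-∑ : (a : R) (xs : List A) (f : A → R) → a * ∑ xs f ≡ ∑[ x ∈ xs ] (a * f x)
    *-distribˡ-∑ a []       f = zeroʳ a
    *-distribˡ-∑ a (x ∷ xs) f = trans (distribˡ a _ _) (cong (a * f x +_) (*-distribˡ-∑ a xs f))

    *-distribʳ-∑ : (a : R) (xs : List A) (f : A → R) → ∑ xs f * a ≡ ∑[ x ∈ xs ] (f x * a)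
    *-distribʳ-∑ a xs f =
      trans (*-comm _ a) (trans (*-distribˡ-∑ a xs f) (∑-cong xs (λ _ → *-comm a _)))

    -‿distrib-∑ : (xs : List A) (f : A → R) → - ∑ xs f ≡ ∑[ x ∈ xs ] - f x
    -‿distrib-∑ xs f = begin
      - ∑ xs f                ≡⟨ -1*x≈-x _ ⟨
      - 1# * ∑ xs f           ≡⟨ *-distribˡ-∑ (- 1#) xs f ⟩
      ∑[ x ∈ xs ] - 1# * f x  ≡⟨ ∑-cong xs (λ _ → -1*x≈-x _) ⟩
      ∑[ x ∈ xs ] - f x       ∎
      where open ≡-Reasoning

    ∑-filterᵇ : (p : A → Bool) (xs : List A) (f : A → R) → ∑ (filterᵇ p xs) f ≡ ∑[ x ∈ xs ] ⟦ p x ⟧ * f x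
    ∑-filterᵇ p []       f = refl
    ∑-filterᵇ p (x ∷ xs) f with p x
    ... | true  = cong₂ _+_ (sym (*-identityˡ _)) (∑-filterᵇ p xs f)
    ... | false = trans (∑-filterᵇ p xs f)
                        (sym (trans (cong (_+ (∑[ y ∈ xs ] ⟦ p y ⟧ * f y)) (zeroˡ (f x))) (+-identityˡ _)))

    ⟦all⟧ : (p : A → Bool) (xs : List A) → ⟦ all p xs ⟧ ≡ ∏[ x ∈ xs ] ⟦ p x ⟧
    ⟦all⟧ p []       = refl
    ⟦all⟧ p (x ∷ xs) with p x
    ... | true  = trans (⟦all⟧ p xs) (sym (*-identityˡ _))
    ... | false = sym (zeroˡ _)

    ∏-⟦⟧-1 : (b : A → Bool) (xs : List A) →
             ∏[ x ∈ xs ] (⟦ b x ⟧ + - 1#) ≡ -1^ length xs * ⟦ all (not ∘ b) xs ⟧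
    ∏-⟦⟧-1 b []       = sym (*-identityˡ 1#)
    ∏-⟦⟧-1 b (x ∷ xs) with b x
    ... | true  = trans (cong (_* (∏[ y ∈ xs ] (⟦ b y ⟧ + - 1#))) (-‿inverseʳ 1#))
                        (trans (zeroˡ _) (sym (zeroʳ _)))
    ... | false = begin
      (0# + - 1#) * (∏[ y ∈ xs ] (⟦ b y ⟧ + - 1#))  ≡⟨ cong₂ _*_ (+-identityˡ _) (∏-⟦⟧-1 b xs) ⟩
      - 1# * (-1^ length xs * ⟦ all (not ∘ b) xs ⟧)  ≡⟨ -1*x≈-x _ ⟩
      - (-1^ length xs * ⟦ all (not ∘ b) xs ⟧)       ≡⟨ -‿distribˡ-* _ _ ⟩
      - (-1^ length xs) * ⟦ all (not ∘ b) xs ⟧       ∎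
      where open ≡-Reasoning

  module _ {A B : Set} where

    ∑-map : (g : A → B) (xs : List A) (f : B → R) → ∑ (map g xs) f ≡ ∑[ x ∈ xs ] f (g x)
    ∑-map g xs f = cong (foldr _+_ 0#) (sym (List.map-∘ xs))

    ∏-map : (g : A → B) (xs : List A) (f : B → R) → ∏ (map g xs) f ≡ ∏[ x ∈ xs ] f (g x)
    ∏-map g xs f = cong (foldr _*_ 1#) (sym (List.map-∘ xs))

    ∑-comm : (xs : List A) (ys : List B) (f : A → B → R) →
             ∑[ x ∈ xs ] ∑[ y ∈ ys ] f x y ≡ ∑[ y ∈ ys ] ∑[ x ∈ xs ] f x y
    ∑-comm []       ys f = sym (∑-zero ys)
    ∑-comm (x ∷ xs) ys f =
      trans (cong (∑ ys (f x) +_) (∑-comm xs ys f)) (sym (∑-distrib-+ ys (f x) _))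

    ∑-concatMap : (h : A → List B) (xs : List A) (f : B → R) →
                  ∑ (concatMap h xs) f ≡ ∑[ x ∈ xs ] ∑ (h x) f
    ∑-concatMap h []       f = refl
    ∑-concatMap h (x ∷ xs) f =
      trans (∑-++ (h x) (concatMap h xs) f) (cong (∑ (h x) f +_) (∑-concatMap h xs f))

  ∑-cartesian : {A : Set} (xss : List (List A)) (w : A → R) →
                ∑[ g ∈ cartesian xss ] ∏ g w ≡ ∏[ xs ∈ xss ] ∑ xs w
  ∑-cartesian []         w = +-identityʳ 1#
  ∑-cartesian (xs ∷ xss) w = begin
    ∑ (concatMap (λ x → map (x ∷_) (cartesian xss)) xs) (λ g → ∏ g w)
      ≡⟨ ∑-concatMap _ xs _ ⟩
    ∑[ x ∈ xs ] ∑ (map (x ∷_) (cartesian xss)) (λ g → ∏ g w)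
      ≡⟨ ∑-cong xs (λ {x} _ → ∑-map (x ∷_) (cartesian xss) (λ g → ∏ g w)) ⟩
    ∑[ x ∈ xs ] ∑[ g ∈ cartesian xss ] w x * ∏ g w
      ≡⟨ ∑-cong xs (λ {x} _ → *-distribˡ-∑ (w x) (cartesian xss) _) ⟨
    ∑[ x ∈ xs ] w x * (∑[ g ∈ cartesian xss ] ∏ g w)
      ≡⟨ ∑-cong xs (λ {x} _ → cong (w x *_) (∑-cartesian xss w)) ⟩
    ∑[ x ∈ xs ] w x * (∏[ ys ∈ xss ] ∑ ys w)
      ≡⟨ *-distribʳ-∑ _ xs w ⟨
    ∑ xs w * (∏[ ys ∈ xss ] ∑ ys w) ∎
    where open ≡-Reasoning

-- Signed counts of assignments

module Counting {R : Set} {add mul : Op₂ R} { -_ : Op₁ R} {0# 1# : R}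
                (isCommutativeRing : IsCommutativeRing _≡_ add mul -_ 0# 1#) where

  open BigOperators isCommutativeRing public

  ⟦⟧-+-disjoint : ∀ a b → a ∧ b ≡ false → ⟦ a ⟧ + ⟦ b ⟧ ≡ ⟦ a ∨ b ⟧
  ⟦⟧-+-disjoint true  false _ = +-identityʳ 1#
  ⟦⟧-+-disjoint false b     _ = +-identityˡ ⟦ b ⟧

  ⟦≡ᵇ⟧-*-≢ : ∀ {e m} (x : R) → e ≢ m → ⟦ e ≡ᵇ m ⟧ * x ≡ 0#
  ⟦≡ᵇ⟧-*-≢ x e≢m = trans (cong (λ b → ⟦ b ⟧ * x) (≢⇒≡ᵇ≡false e≢m)) (zeroˡ x)

  ⟦proper⟧+⟦empty⟧+⟦full⟧ : ∀ e q → e ≤ q → 0 < q →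
    ⟦ (0 <ᵇ e) ∧ (e <ᵇ q) ⟧ + (⟦ e ≡ᵇ 0 ⟧ + ⟦ e ≡ᵇ q ⟧) ≡ 1#
  ⟦proper⟧+⟦empty⟧+⟦full⟧ zero    (suc q) _         _ = trans (+-identityˡ _) (+-identityʳ 1#)
  ⟦proper⟧+⟦empty⟧+⟦full⟧ (suc e) (suc q) (s≤s e≤q) _ =
    trans (cong (⟦ e <ᵇ q ⟧ +_) (+-identityˡ _)) (⟦<ᵇ⟧+⟦≡ᵇ⟧ e q e≤q)
    where
    ⟦<ᵇ⟧+⟦≡ᵇ⟧ : ∀ e q → e ≤ q → ⟦ e <ᵇ q ⟧ + ⟦ e ≡ᵇ q ⟧ ≡ 1#
    ⟦<ᵇ⟧+⟦≡ᵇ⟧ zero    zero    _         = +-identityˡ 1#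
    ⟦<ᵇ⟧+⟦≡ᵇ⟧ zero    (suc q) _         = +-identityʳ 1#
    ⟦<ᵇ⟧+⟦≡ᵇ⟧ (suc e) (suc q) (s≤s e≤q) = ⟦<ᵇ⟧+⟦≡ᵇ⟧ e q e≤q

  ∑-downFrom-⟦≡ᵇ⟧ : (φ : ℕ → R) {e : ℕ} → ∀ B → e < B → ∑[ m ∈ downFrom B ] ⟦ e ≡ᵇ m ⟧ * φ m ≡ φ e
  ∑-downFrom-⟦≡ᵇ⟧ φ {e} (suc B) e<1+B with ℕₚ.m≤n⇒m<n∨m≡n (ℕₚ.≤-pred e<1+B)
  ... | inj₁ e<B  =
    trans (cong₂ _+_ (⟦≡ᵇ⟧-*-≢ (φ B) (ℕₚ.<⇒≢ e<B)) (∑-downFrom-⟦≡ᵇ⟧ φ B e<B)) (+-identityˡ _)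
  ... | inj₂ refl = begin
    ⟦ e ≡ᵇ e ⟧ * φ e + (∑[ m ∈ downFrom e ] ⟦ e ≡ᵇ m ⟧ * φ m)
      ≡⟨ cong₂ _+_ (cong (λ b → ⟦ b ⟧ * φ e) (≡ᵇ-refl e))
                   (∑-cong (downFrom e) (λ m∈ → ⟦≡ᵇ⟧-*-≢ _ (ℕₚ.>⇒≢ (∈-downFrom⁻ m∈)))) ⟩
    1# * φ e + (∑[ m ∈ downFrom e ] 0#)  ≡⟨ cong₂ _+_ (*-identityˡ _) (∑-zero (downFrom e)) ⟩
    φ e + 0#                              ≡⟨ +-identityʳ _ ⟩
    φ e                                   ∎
    where open ≡-Reasoning

  module _ {A : Set} where

    ∑-sublists-∷ : (x : A) (Q : List A) (f : List A → R) →
                   ∑ (sublists (x ∷ Q)) f ≡ (∑[ E ∈ sublists Q ] f (x ∷ E)) + ∑ (sublists Q) f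
    ∑-sublists-∷ x Q f = trans (∑-++ (map (x ∷_) (sublists Q)) (sublists Q) f)
                               (cong (_+ ∑ (sublists Q) f) (∑-map (x ∷_) (sublists Q) f))

    ∑-sublists-alternating : (m : A → Bool) (Q : List A) →
                             ∑[ E ∈ sublists Q ] -1^ length E * ⟦ all m E ⟧ ≡ ⟦ all (not ∘ m) Q ⟧
    ∑-sublists-alternating m []      = trans (+-identityʳ _) (*-identityˡ 1#)
    ∑-sublists-alternating m (x ∷ Q) with m x in mx
    ... | true = begin
      ∑ (sublists (x ∷ Q)) F                              ≡⟨ ∑-sublists-∷ x Q F ⟩
      (∑[ E ∈ sublists Q ] F (x ∷ E)) + ∑ (sublists Q) F
        ≡⟨ cong (_+ ∑ (sublists Q) F) (∑-cong (sublists Q) F-∷) ⟩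
      (∑[ E ∈ sublists Q ] - F E) + ∑ (sublists Q) F
        ≡⟨ cong (_+ ∑ (sublists Q) F) (-‿distrib-∑ (sublists Q) F) ⟨
      - ∑ (sublists Q) F + ∑ (sublists Q) F                ≡⟨ -‿inverseˡ _ ⟩
      0#                                                   ∎
      where
      open ≡-Reasoning
      F : List A → R
      F E = -1^ length E * ⟦ all m E ⟧
      F-∷ : ∀ {E} → E ∈ sublists Q → F (x ∷ E) ≡ - F E
      F-∷ {E} _ = trans (cong (λ b → - (-1^ length E) * ⟦ b ∧ all m E ⟧) mx) (sym (-‿distribˡ-* _ _))
    ... | false = begin
      ∑ (sublists (x ∷ Q)) F                              ≡⟨ ∑-sublists-∷ x Q F ⟩
      (∑[ E ∈ sublists Q ] F (x ∷ E)) + ∑ (sublists Q) F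
        ≡⟨ cong (_+ ∑ (sublists Q) F) (trans (∑-cong (sublists Q) F-∷) (∑-zero (sublists Q))) ⟩
      0# + ∑ (sublists Q) F                                ≡⟨ +-identityˡ _ ⟩
      ∑ (sublists Q) F                                     ≡⟨ ∑-sublists-alternating m Q ⟩
      ⟦ all (not ∘ m) Q ⟧                                  ∎
      where
      open ≡-Reasoning
      F : List A → R
      F E = -1^ length E * ⟦ all m E ⟧
      F-∷ : ∀ {E} → E ∈ sublists Q → F (x ∷ E) ≡ 0#
      F-∷ {E} _ = trans (cong (λ b → - (-1^ length E) * ⟦ b ∧ all m E ⟧) mx) (zeroʳ _)

    ∑-sublists-empty : (Q : List A) (f : List A → R) → ∑[ E ∈ sublists Q ] ⟦ length E ≡ᵇ 0 ⟧ * f E ≡ f []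
    ∑-sublists-empty []      f = trans (+-identityʳ _) (*-identityˡ _)
    ∑-sublists-empty (x ∷ Q) f = begin
      ∑ (sublists (x ∷ Q)) F                                    ≡⟨ ∑-sublists-∷ x Q F ⟩
      (∑[ E ∈ sublists Q ] 0# * f (x ∷ E)) + ∑ (sublists Q) F
        ≡⟨ cong (_+ ∑ (sublists Q) F) (trans (∑-cong (sublists Q) (λ _ → zeroˡ _)) (∑-zero (sublists Q))) ⟩
      0# + ∑ (sublists Q) F                                      ≡⟨ +-identityˡ _ ⟩
      ∑ (sublists Q) F                                           ≡⟨ ∑-sublists-empty Q f ⟩
      f []                                                       ∎
      where
      open ≡-Reasoning
      F : List A → R
      F E = ⟦ length E ≡ᵇ 0 ⟧ * f E

    ∑-sublists-full : (Q : List A) (f : List A → R) →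
                      ∑[ E ∈ sublists Q ] ⟦ length E ≡ᵇ length Q ⟧ * f E ≡ f Q
    ∑-sublists-full []      f = trans (+-identityʳ _) (*-identityˡ _)
    ∑-sublists-full (x ∷ Q) f = begin
      ∑ (sublists (x ∷ Q)) F                                                     ≡⟨ ∑-sublists-∷ x Q F ⟩
      (∑[ E ∈ sublists Q ] ⟦ length E ≡ᵇ length Q ⟧ * f (x ∷ E)) + ∑ (sublists Q) F
        ≡⟨ cong₂ _+_ (∑-sublists-full Q (f ∘ (x ∷_)))
                     (trans (∑-cong (sublists Q) shorter) (∑-zero (sublists Q))) ⟩
      f (x ∷ Q) + 0#                                                              ≡⟨ +-identityʳ _ ⟩
      f (x ∷ Q)                                                                   ∎
      where
      open ≡-Reasoning
      F : List A → R
      F E = ⟦ length E ≡ᵇ suc (length Q) ⟧ * f E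
      shorter : ∀ {E} → E ∈ sublists Q → F E ≡ 0#
      shorter {E} E∈ = ⟦≡ᵇ⟧-*-≢ (f E) (ℕₚ.<⇒≢ (s≤s (∈-sublists⇒length≤ Q E∈)))

    ∑-sublists-split : (Q : List A) (f : List A → R) → 0 < length Q →
                       ∑ (properSublists Q) f + (f [] + f Q) ≡ ∑ (sublists Q) f
    ∑-sublists-split Q f 0<|Q| = begin
      ∑ (properSublists Q) f + (f [] + f Q)
        ≡⟨ cong₂ _+_ (∑-filterᵇ proper S f) (sym (cong₂ _+_ (∑-sublists-empty Q f) (∑-sublists-full Q f))) ⟩
      (∑[ E ∈ S ] ⟦ proper E ⟧ * f E) + ((∑[ E ∈ S ] ⟦ empty E ⟧ * f E) + (∑[ E ∈ S ] ⟦ full E ⟧ * f E))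
        ≡⟨ cong ((∑[ E ∈ S ] ⟦ proper E ⟧ * f E) +_) (∑-distrib-+ S _ _) ⟨
      (∑[ E ∈ S ] ⟦ proper E ⟧ * f E) + (∑[ E ∈ S ] (⟦ empty E ⟧ * f E + ⟦ full E ⟧ * f E))
        ≡⟨ ∑-distrib-+ S _ _ ⟨
      ∑[ E ∈ S ] (⟦ proper E ⟧ * f E + (⟦ empty E ⟧ * f E + ⟦ full E ⟧ * f E))
        ≡⟨ ∑-cong S partition ⟩
      ∑ S f ∎
      where
      open ≡-Reasoning
      S : List (List A)
      S = sublists Q
      proper empty full : List A → Bool
      proper E = (0 <ᵇ length E) ∧ (length E <ᵇ length Q)
      empty  E = length E ≡ᵇ 0
      full   E = length E ≡ᵇ length Q
      partition : ∀ {E} → E ∈ S → ⟦ proper E ⟧ * f E + (⟦ empty E ⟧ * f E + ⟦ full E ⟧ * f E) ≡ f E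
      partition {E} E∈ = begin
        ⟦ proper E ⟧ * f E + (⟦ empty E ⟧ * f E + ⟦ full E ⟧ * f E)
          ≡⟨ cong (⟦ proper E ⟧ * f E +_) (distribʳ _ _ _) ⟨
        ⟦ proper E ⟧ * f E + (⟦ empty E ⟧ + ⟦ full E ⟧) * f E
          ≡⟨ distribʳ _ _ _ ⟨
        (⟦ proper E ⟧ + (⟦ empty E ⟧ + ⟦ full E ⟧)) * f E
          ≡⟨ cong (_* f E) (⟦proper⟧+⟦empty⟧+⟦full⟧ _ _ (∈-sublists⇒length≤ Q E∈) 0<|Q|) ⟩
        1# * f E
          ≡⟨ *-identityˡ _ ⟩
        f E ∎

    ∑-properSublists-alternating : (m : A → Bool) (Q : List A) → 0 < length Q → -1^ length Q ≡ - 1# →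
      ∑[ E ∈ properSublists Q ] -1^ length E * ⟦ all m E ⟧ ≡ ⟦ monochromatic m Q ⟧ + - 1#
    ∑-properSublists-alternating m Q@(q ∷ Q′) 0<|Q| |Q|-odd = begin
      ∑ (properSublists Q) F                    ≡⟨ x+[1-b]≡a⇒x≡a+b-1 split ⟩
      ⟦ all (not ∘ m) Q ⟧ + ⟦ all m Q ⟧ + - 1#  ≡⟨ cong (_+ - 1#) (⟦⟧-+-disjoint _ _ (not-both (m q))) ⟩
      ⟦ monochromatic m Q ⟧ + - 1#              ∎
      where
      open ≡-Reasoning
      F : List A → R
      F E = -1^ length E * ⟦ all m E ⟧
      F-full : F Q ≡ - ⟦ all m Q ⟧
      F-full = trans (cong (_* ⟦ all m Q ⟧) |Q|-odd) (-1*x≈-x _)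
      split : ∑ (properSublists Q) F + (1# + - ⟦ all m Q ⟧) ≡ ⟦ all (not ∘ m) Q ⟧
      split = begin
        ∑ (properSublists Q) F + (1# + - ⟦ all m Q ⟧)
          ≡⟨ cong (∑ (properSublists Q) F +_) (cong₂ _+_ (*-identityˡ 1#) F-full) ⟨
        ∑ (properSublists Q) F + (F [] + F Q)  ≡⟨ ∑-sublists-split Q F 0<|Q| ⟩
        ∑ (sublists Q) F                       ≡⟨ ∑-sublists-alternating m Q ⟩
        ⟦ all (not ∘ m) Q ⟧                    ∎
      not-both : ∀ b → (not b ∧ all (not ∘ m) Q′) ∧ (b ∧ all m Q′) ≡ false
      not-both true  = refl
      not-both false = ∧-zeroʳ _

  -- The coefficient of t^m in ∏ᵢ (if Gᵢ then t else 1 - t).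
  bernsteinCoeff : List Bool → ℕ → R
  bernsteinCoeff []          m       = ⟦ 0 ≡ᵇ m ⟧
  bernsteinCoeff (true ∷ G)  zero    = 0#
  bernsteinCoeff (true ∷ G)  (suc m) = bernsteinCoeff G m
  bernsteinCoeff (false ∷ G) zero    = bernsteinCoeff G zero
  bernsteinCoeff (false ∷ G) (suc m) = bernsteinCoeff G (suc m) + - bernsteinCoeff G m

  bernsteinCoeff-true+false : ∀ G m →
                              bernsteinCoeff (true ∷ G) m + bernsteinCoeff (false ∷ G) m ≡ bernsteinCoeff G m
  bernsteinCoeff-true+false G zero    = +-identityˡ _
  bernsteinCoeff-true+false G (suc m) = trans (sym (+-assoc _ _ _)) (xyx⁻¹≈y _ _)

  ∑-bitLists-suc : ∀ N (f : List Bool → R) →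
    ∑ (bitLists (suc N)) f ≡ (∑[ G ∈ bitLists N ] f (true ∷ G)) + (∑[ G ∈ bitLists N ] f (false ∷ G))
  ∑-bitLists-suc N f = trans (∑-++ (map (true ∷_) (bitLists N)) (map (false ∷_) (bitLists N)) f)
                             (cong₂ _+_ (∑-map _ (bitLists N) f) (∑-map _ (bitLists N) f))

  ∑-bitLists-⊆-uniform : ∀ {u} → u + u ≡ 1# → ∀ N c → length c ≡ N →
                         ∑[ G ∈ bitLists N ] u ^ N * ⟦ c ⊆ᵇ G ⟧ ≡ u ^ countTrue c
  ∑-bitLists-⊆-uniform     u+u≡1 zero    []      refl = trans (+-identityʳ _) (*-identityˡ 1#)
  ∑-bitLists-⊆-uniform {u} u+u≡1 (suc N) (b ∷ c) refl = trans (∑-bitLists-suc N _) (by-bit b)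
    where
    open ≡-Reasoning
    halve : ∑[ G ∈ bitLists N ] u ^ suc N * ⟦ c ⊆ᵇ G ⟧ ≡ u * u ^ countTrue c
    halve = begin
      ∑[ G ∈ bitLists N ] u * u ^ N * ⟦ c ⊆ᵇ G ⟧    ≡⟨ ∑-cong (bitLists N) (λ _ → *-assoc _ _ _) ⟩
      ∑[ G ∈ bitLists N ] u * (u ^ N * ⟦ c ⊆ᵇ G ⟧)  ≡⟨ *-distribˡ-∑ u (bitLists N) _ ⟨
      u * (∑[ G ∈ bitLists N ] u ^ N * ⟦ c ⊆ᵇ G ⟧)  ≡⟨ cong (u *_) (∑-bitLists-⊆-uniform u+u≡1 N c refl) ⟩
      u * u ^ countTrue c                            ∎
    by-bit : ∀ b → (∑[ G ∈ bitLists N ] u ^ suc N * ⟦ (b ∷ c) ⊆ᵇ (true ∷ G) ⟧)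
                   + (∑[ G ∈ bitLists N ] u ^ suc N * ⟦ (b ∷ c) ⊆ᵇ (false ∷ G) ⟧) ≡ u ^ countTrue (b ∷ c)
    by-bit true  = trans (cong₂ _+_ halve (∑-*-zeroʳ (bitLists N) _)) (+-identityʳ _)
    by-bit false = begin
      (∑[ G ∈ bitLists N ] u ^ suc N * ⟦ c ⊆ᵇ G ⟧) + (∑[ G ∈ bitLists N ] u ^ suc N * ⟦ c ⊆ᵇ G ⟧)
        ≡⟨ cong₂ _+_ halve halve ⟩
      u * u ^ countTrue c + u * u ^ countTrue c  ≡⟨ distribʳ _ u u ⟨
      (u + u) * u ^ countTrue c                  ≡⟨ cong (_* u ^ countTrue c) u+u≡1 ⟩
      1# * u ^ countTrue c                       ≡⟨ *-identityˡ _ ⟩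
      u ^ countTrue c                            ∎

  ∑-bitLists-⊆-bernsteinCoeff : ∀ N c → length c ≡ N → ∀ m →
                                ∑[ G ∈ bitLists N ] bernsteinCoeff G m * ⟦ c ⊆ᵇ G ⟧ ≡ ⟦ countTrue c ≡ᵇ m ⟧
  ∑-bitLists-⊆-bernsteinCoeff zero    []          refl m = trans (+-identityʳ _) (*-identityʳ _)
  ∑-bitLists-⊆-bernsteinCoeff (suc N) (true ∷ c)  refl m = begin
    ∑ (bitLists (suc N)) (λ G → bernsteinCoeff G m * ⟦ (true ∷ c) ⊆ᵇ G ⟧)
      ≡⟨ ∑-bitLists-suc N _ ⟩
    (∑[ G ∈ bitLists N ] bernsteinCoeff (true ∷ G) m * ⟦ c ⊆ᵇ G ⟧)
      + (∑[ G ∈ bitLists N ] bernsteinCoeff (false ∷ G) m * 0#)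
      ≡⟨ cong₂ _+_ (shift m) (∑-*-zeroʳ (bitLists N) _) ⟩
    ⟦ suc (countTrue c) ≡ᵇ m ⟧ + 0#  ≡⟨ +-identityʳ _ ⟩
    ⟦ suc (countTrue c) ≡ᵇ m ⟧       ∎
    where
    open ≡-Reasoning
    shift : ∀ m → ∑[ G ∈ bitLists N ] bernsteinCoeff (true ∷ G) m * ⟦ c ⊆ᵇ G ⟧ ≡ ⟦ suc (countTrue c) ≡ᵇ m ⟧
    shift zero    = trans (∑-cong (bitLists N) (λ _ → zeroˡ _)) (∑-zero (bitLists N))
    shift (suc m) = ∑-bitLists-⊆-bernsteinCoeff N c refl m
  ∑-bitLists-⊆-bernsteinCoeff (suc N) (false ∷ c) refl m = begin
    ∑ (bitLists (suc N)) (λ G → bernsteinCoeff G m * ⟦ (false ∷ c) ⊆ᵇ G ⟧)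
      ≡⟨ ∑-bitLists-suc N _ ⟩
    (∑[ G ∈ bitLists N ] bernsteinCoeff (true ∷ G) m * ⟦ c ⊆ᵇ G ⟧)
      + (∑[ G ∈ bitLists N ] bernsteinCoeff (false ∷ G) m * ⟦ c ⊆ᵇ G ⟧)
      ≡⟨ ∑-distrib-+ (bitLists N) _ _ ⟨
    ∑[ G ∈ bitLists N ] (bernsteinCoeff (true ∷ G) m * ⟦ c ⊆ᵇ G ⟧ + bernsteinCoeff (false ∷ G) m * ⟦ c ⊆ᵇ G ⟧)
      ≡⟨ ∑-cong (bitLists N) (λ {G} _ → trans (sym (distribʳ _ _ _))
                                              (cong (_* ⟦ c ⊆ᵇ G ⟧) (bernsteinCoeff-true+false G m))) ⟩
    ∑[ G ∈ bitLists N ] bernsteinCoeff G m * ⟦ c ⊆ᵇ G ⟧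
      ≡⟨ ∑-bitLists-⊆-bernsteinCoeff N c refl m ⟩
    ⟦ countTrue c ≡ᵇ m ⟧ ∎
    where open ≡-Reasoning

  signOf : {A : Set} → List (List A) → R
  signOf g = ∏[ E ∈ g ] -1^ length E

  module _ (n k : ℕ) where

    ∑-assignments-via-graphs : (V : List Bool → R) (φ : ℕ → R) →
      (∀ c → length c ≡ length (allPairs n) → ∑[ G ∈ graphs n ] V G * ⟦ c ⊆ᵇ G ⟧ ≡ φ (countTrue c)) →
      ∑[ g ∈ assignments n k ] signOf g * φ (numEdges g)
        ≡ ∑[ G ∈ graphs n ] V G * (∑[ g ∈ assignments n k ] signOf g * ⟦ edgeBits g ⊆ᵇ G ⟧)
    ∑-assignments-via-graphs V φ ∑-V-⊆ = begin
      ∑[ g ∈ assignments n k ] signOf g * φ (numEdges g)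
        ≡⟨ ∑-cong (assignments n k) (λ {g} _ → cong (signOf g *_) (expand g)) ⟩
      ∑[ g ∈ assignments n k ] signOf g * (∑[ G ∈ graphs n ] V G * ⟦ edgeBits g ⊆ᵇ G ⟧)
        ≡⟨ ∑-cong (assignments n k) (λ {g} _ → *-distribˡ-∑ (signOf g) (graphs n) _) ⟩
      ∑[ g ∈ assignments n k ] ∑[ G ∈ graphs n ] signOf g * (V G * ⟦ edgeBits g ⊆ᵇ G ⟧)
        ≡⟨ ∑-comm (assignments n k) (graphs n) _ ⟩
      ∑[ G ∈ graphs n ] ∑[ g ∈ assignments n k ] signOf g * (V G * ⟦ edgeBits g ⊆ᵇ G ⟧)
        ≡⟨ ∑-cong (graphs n) (λ {G} _ → trans (∑-cong (assignments n k) (λ _ → x*yz≡y*xz _ _ _))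
                                              (sym (*-distribˡ-∑ (V G) (assignments n k) _))) ⟩
      ∑[ G ∈ graphs n ] V G * (∑[ g ∈ assignments n k ] signOf g * ⟦ edgeBits g ⊆ᵇ G ⟧) ∎
      where
      open ≡-Reasoning
      expand : ∀ g → φ (numEdges g) ≡ ∑[ G ∈ graphs n ] V G * ⟦ edgeBits g ⊆ᵇ G ⟧
      expand g = trans (cong φ (numEdges≡countTrue-edgeBits g))
                       (sym (∑-V-⊆ (edgeBits g) (List.length-map (isEdgeOf g) (allPairs n))))

    ∑-assignments-⊆ : ∀ G →
      ∑[ g ∈ assignments n k ] signOf g * ⟦ edgeBits g ⊆ᵇ G ⟧
        ≡ ∏[ S ∈ kSubsets n k ] ∑[ E ∈ properGraphs S ] -1^ length E * ⟦ all (hasEdge (allPairs n) G) E ⟧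
    ∑-assignments-⊆ G = begin
      ∑[ g ∈ assignments n k ] signOf g * ⟦ edgeBits g ⊆ᵇ G ⟧
        ≡⟨ ∑-cong (assignments n k) (λ {g} _ → factor g) ⟩
      ∑[ g ∈ assignments n k ] ∏ g w
        ≡⟨ ∑-cartesian (map properGraphs (kSubsets n k)) w ⟩
      ∏[ Es ∈ map properGraphs (kSubsets n k) ] ∑ Es w
        ≡⟨ ∏-map properGraphs (kSubsets n k) (λ Es → ∑ Es w) ⟩
      ∏[ S ∈ kSubsets n k ] ∑ (properGraphs S) w ∎
      where
      open ≡-Reasoning
      inG : Edge n → Bool
      inG = hasEdge (allPairs n) G
      w : List (Edge n) → R
      w E = -1^ length E * ⟦ all inG E ⟧
      factor : ∀ g → signOf g * ⟦ edgeBits g ⊆ᵇ G ⟧ ≡ ∏ g w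
      factor g = begin
        signOf g * ⟦ edgeBits g ⊆ᵇ G ⟧
          ≡⟨ cong (λ b → signOf g * ⟦ b ⟧) (map-isEdgeOf-⊆ᵇ g (allPairs n) G) ⟩
        signOf g * ⟦ all (all inG) g ⟧         ≡⟨ cong (signOf g *_) (⟦all⟧ (all inG) g) ⟩
        signOf g * (∏[ E ∈ g ] ⟦ all inG E ⟧)  ≡⟨ ∏-distrib-* g _ _ ⟨
        ∏ g w                                  ∎

    module _ (2≤k : 2 ≤ k) (kC2-odd : parity (k C 2) ≡ 1ℙ) where

      ∑-properGraphs-alternating : ∀ G {S} → S ∈ kSubsets n k →
        ∑[ E ∈ properGraphs S ] -1^ length E * ⟦ all (hasEdge (allPairs n) G) E ⟧
          ≡ ⟦ monochromaticIn G S ⟧ + - 1#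
      ∑-properGraphs-alternating G {S} S∈ =
        ∑-properSublists-alternating (hasEdge (allPairs n) G) (pairsOf S)
          (subst (0 <_) (sym |pairs|≡kC2) (2≤n⇒0<nC2 2≤k))
          (-1^-odd (length (pairsOf S)) (subst (λ m → parity m ≡ 1ℙ) (sym |pairs|≡kC2) kC2-odd))
        where
        |pairs|≡kC2 : length (pairsOf S) ≡ k C 2
        |pairs|≡kC2 = trans (length-pairsOf S) (cong (_C 2) (∈-choose⇒length≡ k (allFin n) S∈))

      ∑-assignments-⊆-isRamseyGraph : ∀ G →
        ∑[ g ∈ assignments n k ] signOf g * ⟦ edgeBits g ⊆ᵇ G ⟧
          ≡ -1^ length (kSubsets n k) * ⟦ isRamseyGraph n k G ⟧
      ∑-assignments-⊆-isRamseyGraph G =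
        trans (∑-assignments-⊆ G)
              (trans (∏-cong (kSubsets n k) (∑-properGraphs-alternating G))
                     (∏-⟦⟧-1 (monochromaticIn G) (kSubsets n k)))

      ∑-assignments≡∑-RamseyGraphs : (V : List Bool → R) (φ : ℕ → R) →
        (∀ c → length c ≡ length (allPairs n) → ∑[ G ∈ graphs n ] V G * ⟦ c ⊆ᵇ G ⟧ ≡ φ (countTrue c)) →
        ∑[ g ∈ assignments n k ] signOf g * φ (numEdges g)
          ≡ -1^ length (kSubsets n k) * (∑[ G ∈ graphs n ] V G * ⟦ isRamseyGraph n k G ⟧)
      ∑-assignments≡∑-RamseyGraphs V φ ∑-V-⊆ =
        trans (∑-assignments-via-graphs V φ ∑-V-⊆)
              (trans (∑-cong (graphs n) (λ {G} _ → trans (cong (V G *_) (∑-assignments-⊆-isRamseyGraph G))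
                                                         (x*yz≡y*xz _ _ _)))
                     (sym (*-distribˡ-∑ _ (graphs n) _)))

-- The integer and rational cases

module ℤᶜ = Counting ℤₚ.+-*-isCommutativeRing
module ℚᶜ = Counting ℚₚ.+-*-isCommutativeRing

negOnePow≡-1^ : ∀ m → negOnePow m ≡ ℤᶜ.-1^ m
negOnePow≡-1^ zero    = refl
negOnePow≡-1^ (suc m) = cong ℤ.-_ (negOnePow≡-1^ m)

sign≡signOf : ∀ {n} (g : List (List (Edge n))) → sign g ≡ ℤᶜ.signOf g
sign≡signOf []      = refl
sign≡signOf (E ∷ g) = cong₂ ℤ._*_ (negOnePow≡-1^ (length E)) (sign≡signOf g)

ι : ℤ → ℚ
ι x = x ℚ./ 1

ι≡mkℚ : ∀ x → ι x ≡ mkℚ x 0 (Coprime.sym (Coprime.1-coprimeTo ℤ.∣ x ∣))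
ι≡mkℚ (ℤ.+ m)  = ℚₚ.normalize-coprime (Coprime.sym (Coprime.1-coprimeTo m))
ι≡mkℚ -[1+ m ] = cong ℚ.-_ (ℚₚ.normalize-coprime (Coprime.sym (Coprime.1-coprimeTo (suc m))))

ι-+ : ∀ x y → ι (x ℤ.+ y) ≡ ι x ℚ.+ ι y
ι-+ x y = trans (cong₂ (λ a b → ι (a ℤ.+ b)) (sym (ℤₚ.*-identityʳ x)) (sym (ℤₚ.*-identityʳ y)))
                (sym (cong₂ ℚ._+_ (ι≡mkℚ x) (ι≡mkℚ y)))

ι-* : ∀ x y → ι (x ℤ.* y) ≡ ι x ℚ.* ι y
ι-* x y = sym (cong₂ ℚ._*_ (ι≡mkℚ x) (ι≡mkℚ y))

ι-neg : ∀ x → ι (ℤ.- x) ≡ ℚ.- ι x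
ι-neg x = trans (ι≡mkℚ (ℤ.- x)) (trans (mkℚ-neg x) (cong ℚ.-_ (sym (ι≡mkℚ x))))
  where
  mkℚ-neg : ∀ x → mkℚ (ℤ.- x) 0 (Coprime.sym (Coprime.1-coprimeTo ℤ.∣ ℤ.- x ∣))
                ≡ ℚ.- mkℚ x 0 (Coprime.sym (Coprime.1-coprimeTo ℤ.∣ x ∣))
  mkℚ-neg (ℤ.+ zero)  = refl
  mkℚ-neg (ℤ.+ suc m) = refl
  mkℚ-neg -[1+ m ]    = refl

ι[+c]≡0⇒c≡0 : ∀ {c} → ι (ℤ.+ c) ≡ 0ℚ → c ≡ 0
ι[+c]≡0⇒c≡0 {c} eq = cong (ℤ.∣_∣ ∘ ℚ.numerator) (trans (sym (ι≡mkℚ (ℤ.+ c))) eq)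

ι-sumℤ : {A : Set} (xs : List A) (f : A → ℤ) → ι (sumℤ (map f xs)) ≡ ℚᶜ.∑ xs (ι ∘ f)
ι-sumℤ []       f = refl
ι-sumℤ (x ∷ xs) f = trans (ι-+ (f x) _) (cong (ι (f x) ℚ.+_) (ι-sumℤ xs f))

ι-negOnePow : ∀ m → ι (negOnePow m) ≡ ℚᶜ.-1^ m
ι-negOnePow zero    = refl
ι-negOnePow (suc m) = trans (ι-neg (negOnePow m)) (cong ℚ.-_ (ι-negOnePow m))

ι-sign : ∀ {n} (g : List (List (Edge n))) → ι (sign g) ≡ ℚᶜ.signOf g
ι-sign []      = refl
ι-sign (E ∷ g) =
  trans (ι-* (negOnePow (length E)) (sign g)) (cong₂ ℚ._*_ (ι-negOnePow (length E)) (ι-sign g))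

powℚ≡^ : ∀ x m → powℚ x m ≡ x ℚᶜ.^ m
powℚ≡^ x zero    = refl
powℚ≡^ x (suc m) = cong (x ℚ.*_) (powℚ≡^ x m)

∑-⟦⟧≡ι-countTrue : {A : Set} (b : A → Bool) (xs : List A) →
                   ℚᶜ.∑ xs (ℚᶜ.⟦_⟧ ∘ b) ≡ ι (ℤ.+ countTrue (map b xs))
∑-⟦⟧≡ι-countTrue b []       = refl
∑-⟦⟧≡ι-countTrue b (x ∷ xs) with b x
... | true  = trans (cong (1ℚ ℚ.+_) (∑-⟦⟧≡ι-countTrue b xs)) (sym (ι-+ (ℤ.+ 1) (ℤ.+ countTrue (map b xs))))
... | false = trans (ℚₚ.+-identityˡ _) (∑-⟦⟧≡ι-countTrue b xs)

module _ (n k : ℕ) where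

  open ℚᶜ

  evalP≡∑-signOf : ∀ x → evalP n k x ≡ ∑[ g ∈ assignments n k ] signOf g * x ^ numEdges g
  evalP≡∑-signOf x = ∑-cong (assignments n k) (λ {g} _ → cong₂ ℚ._*_ (ι-sign g) (powℚ≡^ x (numEdges g)))

  evalP≡∑-coeffP : ∀ x → evalP n k x ≡ ∑[ m ∈ downFrom (suc (length (allPairs n))) ] ι (coeffP n k m) * x ^ m
  evalP≡∑-coeffP x = begin
    evalP n k x
      ≡⟨ evalP≡∑-signOf x ⟩
    ∑[ g ∈ 𝒜 ] signOf g * x ^ numEdges g
      ≡⟨ ∑-cong 𝒜 (λ {g} _ → cong (signOf g *_) (sym (∑-downFrom-⟦≡ᵇ⟧ (x ^_) (suc _) (numEdges< g)))) ⟩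
    ∑[ g ∈ 𝒜 ] signOf g * (∑[ m ∈ 𝕄 ] ⟦ numEdges g ≡ᵇ m ⟧ * x ^ m)
      ≡⟨ ∑-cong 𝒜 (λ {g} _ → *-distribˡ-∑ (signOf g) 𝕄 _) ⟩
    ∑[ g ∈ 𝒜 ] ∑[ m ∈ 𝕄 ] signOf g * (⟦ numEdges g ≡ᵇ m ⟧ * x ^ m)
      ≡⟨ ∑-comm 𝒜 𝕄 _ ⟩
    ∑[ m ∈ 𝕄 ] ∑[ g ∈ 𝒜 ] signOf g * (⟦ numEdges g ≡ᵇ m ⟧ * x ^ m)
      ≡⟨ ∑-cong 𝕄 (λ {m} _ → trans (∑-cong 𝒜 (λ {g} _ → sym (*-assoc (signOf g) ⟦ numEdges g ≡ᵇ m ⟧ (x ^ m))))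
                                   (sym (*-distribʳ-∑ (x ^ m) 𝒜 _))) ⟩
    ∑[ m ∈ 𝕄 ] (∑[ g ∈ 𝒜 ] signOf g * ⟦ numEdges g ≡ᵇ m ⟧) * x ^ m
      ≡⟨ ∑-cong 𝕄 (λ {m} _ → cong (_* x ^ m) (sym (ι-coeffP m))) ⟩
    ∑[ m ∈ 𝕄 ] ι (coeffP n k m) * x ^ m ∎
    where
    open ≡-Reasoning
    𝒜 : List (List (List (Edge n)))
    𝒜 = assignments n k
    𝕄 : List ℕ
    𝕄 = downFrom (suc (length (allPairs n)))
    numEdges< : ∀ g → numEdges g < suc (length (allPairs n))
    numEdges< g = s≤s (length-filterᵇ≤ (isEdgeOf g) (allPairs n))
    ι-coeffP : ∀ m → ι (coeffP n k m) ≡ ∑[ g ∈ 𝒜 ] signOf g * ⟦ numEdges g ≡ᵇ m ⟧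
    ι-coeffP m = trans (ι-sumℤ 𝒜 _) (∑-cong 𝒜 (λ {g} _ →
      trans (if-float ι (numEdges g ≡ᵇ m))
            (trans (if-then-0# (numEdges g ≡ᵇ m) (ι (sign g))) (cong (_* ⟦ numEdges g ≡ᵇ m ⟧) (ι-sign g)))))

  IsZeroPoly⇒evalP≡0 : IsZeroPoly n k → ∀ x → evalP n k x ≡ 0ℚ
  IsZeroPoly⇒evalP≡0 coeffP≡0 x = begin
    evalP n k x                          ≡⟨ evalP≡∑-coeffP x ⟩
    ∑[ m ∈ 𝕄 ] ι (coeffP n k m) * x ^ m
      ≡⟨ ∑-cong 𝕄 (λ {m} _ → trans (cong (λ c → ι c * x ^ m) (coeffP≡0 m)) (zeroˡ (x ^ m))) ⟩
    ∑[ m ∈ 𝕄 ] 0ℚ                        ≡⟨ ∑-zero 𝕄 ⟩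
    0ℚ                                   ∎
    where
    open ≡-Reasoning
    𝕄 : List ℕ
    𝕄 = downFrom (suc (length (allPairs n)))

module _ (n k : ℕ) (2≤k : 2 ≤ k) (kC2-odd : parity (k C 2) ≡ 1ℙ) where

  ¬isRamseyGraph⇒IsZeroPoly : (∀ G → G ∈ graphs n → isRamseyGraph n k G ≡ false) → IsZeroPoly n k
  ¬isRamseyGraph⇒IsZeroPoly none m = begin
    coeffP n k m
      ≡⟨ ∑-cong (assignments n k) (λ {g} _ → trans (if-then-0# (numEdges g ≡ᵇ m) (sign g))
                                                    (cong (_* ⟦ numEdges g ≡ᵇ m ⟧) (sign≡signOf g))) ⟩
    ∑[ g ∈ assignments n k ] signOf g * ⟦ numEdges g ≡ᵇ m ⟧
      ≡⟨ ∑-assignments≡∑-RamseyGraphs n k 2≤k kC2-odd (λ G → bernsteinCoeff G m) (λ e → ⟦ e ≡ᵇ m ⟧)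
           (λ c |c| → ∑-bitLists-⊆-bernsteinCoeff _ c |c| m) ⟩
    -1^ length (kSubsets n k) * (∑[ G ∈ graphs n ] bernsteinCoeff G m * ⟦ isRamseyGraph n k G ⟧)
      ≡⟨ cong (-1^ length (kSubsets n k) *_)
              (trans (∑-cong (graphs n) (λ {G} G∈ → cong (λ b → bernsteinCoeff G m * ⟦ b ⟧) (none G G∈)))
                     (∑-*-zeroʳ (graphs n) (λ G → bernsteinCoeff G m))) ⟩
    -1^ length (kSubsets n k) * ℤ.0ℤ
      ≡⟨ zeroʳ (-1^ length (kSubsets n k)) ⟩
    ℤ.0ℤ ∎
    where
    open ℤᶜ
    open ≡-Reasoning

  evalP-½ : evalP n k ½ ≡ ℚᶜ.-1^ length (kSubsets n k)
                          ℚ.* (½ ℚᶜ.^ length (allPairs n)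
                               ℚ.* ι (ℤ.+ countTrue (map (isRamseyGraph n k) (graphs n))))
  evalP-½ = begin
    evalP n k ½
      ≡⟨ evalP≡∑-signOf n k ½ ⟩
    ∑[ g ∈ assignments n k ] signOf g * ½ ^ numEdges g
      ≡⟨ ∑-assignments≡∑-RamseyGraphs n k 2≤k kC2-odd (λ _ → ½ ^ N) (½ ^_) (∑-bitLists-⊆-uniform refl N) ⟩
    -1^ M * (∑[ G ∈ graphs n ] ½ ^ N * ⟦ isRamseyGraph n k G ⟧)
      ≡⟨ cong (-1^ M *_) (*-distribˡ-∑ (½ ^ N) (graphs n) _) ⟨
    -1^ M * (½ ^ N * (∑[ G ∈ graphs n ] ⟦ isRamseyGraph n k G ⟧))
      ≡⟨ cong (λ s → -1^ M * (½ ^ N * s)) (∑-⟦⟧≡ι-countTrue (isRamseyGraph n k) (graphs n)) ⟩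
    -1^ M * (½ ^ N * ι (ℤ.+ countTrue (map (isRamseyGraph n k) (graphs n)))) ∎
    where
    open ℚᶜ
    open ≡-Reasoning
    N M : ℕ
    N = length (allPairs n)
    M = length (kSubsets n k)

  evalP-½≡0⇒¬isRamseyGraph : evalP n k ½ ≡ 0ℚ → ∀ G → G ∈ graphs n → isRamseyGraph n k G ≡ false
  evalP-½≡0⇒¬isRamseyGraph evalP≡0 G = countTrue-map≡0 (isRamseyGraph n k) (graphs n) (ι[+c]≡0⇒c≡0 ι-count≡0)
    where
    open ℚᶜ
    N M : ℕ
    N = length (allPairs n)
    M = length (kSubsets n k)
    ι-count≡0 : ι (ℤ.+ countTrue (map (isRamseyGraph n k) (graphs n))) ≡ 0ℚ
    ι-count≡0 = inverse-*-≡0⇒≡0 {u = ι (ℤ.+ 2) ^ N} {v = ½ ^ N} (^-inverse {u = ½} {v = ι (ℤ.+ 2)} refl N)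
                  (inverse-*-≡0⇒≡0 {u = -1^ M} {v = -1^ M} (-1^-*-self M) (trans (sym evalP-½) evalP≡0))

corollary2p4 : (n k : ℕ) → 2 ≤ k → k ≤ n → (k % 4 ≡ 2 ⊎ k % 4 ≡ 3) →
    (r : ℕ) → IsRamseyNumber k r →
    ((evalP n k ½ ≡ 0ℚ) ⇔ IsZeroPoly n k) × (IsZeroPoly n k ⇔ (r ≤ n))
corollary2p4 n k 2≤k k≤n k%4∈23 r (_ , ramsey-r , r-least) = mk⇔ i⇒ii ii⇒i , mk⇔ ii⇒iii iii⇒ii
  where
  kC2-odd : parity (k C 2) ≡ 1ℙ
  kC2-odd = parity-C2-odd k k%4∈23
  i⇒¬isRamseyGraph : evalP n k ½ ≡ 0ℚ → ∀ G → G ∈ graphs n → isRamseyGraph n k G ≡ false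
  i⇒¬isRamseyGraph = evalP-½≡0⇒¬isRamseyGraph n k 2≤k kC2-odd
  i⇒ii : evalP n k ½ ≡ 0ℚ → IsZeroPoly n k
  i⇒ii = ¬isRamseyGraph⇒IsZeroPoly n k 2≤k kC2-odd ∘ i⇒¬isRamseyGraph
  ii⇒i : IsZeroPoly n k → evalP n k ½ ≡ 0ℚ
  ii⇒i coeffP≡0 = IsZeroPoly⇒evalP≡0 n k coeffP≡0 ½
  ii⇒iii : IsZeroPoly n k → r ≤ n
  ii⇒iii = r-least n (ℕₚ.≤-trans (s≤s z≤n) (ℕₚ.≤-trans 2≤k k≤n)) ∘ ¬isRamseyGraph⇒RamseyProp n k
         ∘ i⇒¬isRamseyGraph ∘ ii⇒i
  iii⇒ii : r ≤ n → IsZeroPoly n k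
  iii⇒ii r≤n = ¬isRamseyGraph⇒IsZeroPoly n k 2≤k kC2-odd
                 (λ G _ → RamseyProp⇒¬isRamseyGraph n k (RamseyProp-mono (ℕₚ.≤⇒≤′ r≤n) ramsey-r) G)
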